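{- Let $\overline{\psi_\prec}\in M_A$ be as in the context. For every $n\ge1$, $\overline{\psi_\prec}^{*-1}(J_n)=(-1)^{n+1}\,\mathrm{cat}_n$, where $J_n=\{\{1\},\dots,\{n\}\}$ and $\mathrm{cat}_n=\frac1n\binom{2n-2}{n-1}$.
   Context: $\mathbb K$ is a field of characteristic $0$. Noncrossing partitions (no $a,b$ in one block, $c,d$ in another with $a<c<b<d$) are identified with standard representatives on $[n]$; restrictions $P_{|X}$ are standardized; $\mathrm{NCP}=\bigcup_{n\ge1}\mathrm{NCP}(n)$; $P\le Q$ means each block of $Q$ is a union of blocks of $P$. Cuts: for blocks write $\pi\to\rho$ if $[\min\pi,\max\pi]\cap\rho\neq\emptyset$; uppersets/lowersets are sets of blocks closed upward/downward; a cut $(L,U)$ is a lowerset with its complement. If $x_1<\dots<x_k$ are the elements of $\bigcup L$, let $D_0=\{y<x_1\},D_i=\{x_i<y<x_{i+1}\},D_k=\{y>x_k\}$ ($D_0=[n]$ if $k=0$), $U_i=P_{|D_i}$; the reduced gap monomial is the word of the nonempty $U_i$. $H$: free associative unital algebra on $\mathrm{NCP}$, basis words $P_1\cdots P_r$, $H_+$ spanned by nonempty words, counit $\varepsilon_H$. A cut of $P_1\cdots P_r$ is a tuple of cuts of the $P_i$ with term $L_1\cdots L_r\otimes M_1\cdots M_r$ ($L_i$ the partition of blocks of the lowerset, omitted if empty; $M_i$ the reduced gap monomial). $\Delta_\prec(P)$: sum of terms over cuts where the block containing the element $1$ of $P_1$ lies in $L_1$. For $f,g\in H^*$: $(f\prec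 g)(\mathbf1)=0$, $(f\prec g)(x)=(f\otimes g)\Delta_\prec(x)$ for $x\in H_+$. $e$ is the infinitesimal character of $H$ (linear, vanishing on $\mathbf1$ and on products of two elements of $H_+$) with $e(P)=1$ if $P\in\mathrm{NCP}$ has one block and $0$ for other $P\in\mathrm{NCP}$; $\psi_\prec$ is the unique linear form on $H$ with $\psi_\prec=\varepsilon_H+e\prec\psi_\prec$ (a character of $H$). $A$: free commutative unital algebra on $\mathrm{NCP}$ with coproduct $\delta(P)=\sum_{Q\ge P}Q\otimes P/Q$, $P/Q=\prod_{\tau\in Q}P_{|\tau}$; $M_A$: monoid of characters of $A$ under $\phi*\psi=(\phi\otimes\psi)\circ\delta$, $^{*-1}$ the inverse in it; $\overline{\psi_\prec}\in M_A$ is the character of $A$ with the same values as $\psi_\prec$ on $\mathrm{NCP}$ (it is invertible). -}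

module Defs where

open import Level using (_⊔_)
open import Data.Bool using (Bool; true; false; _∧_; _∨_; not; if_then_else_; T)
open import Data.Nat using (ℕ; zero; suc; _≡ᵇ_; _≤ᵇ_; _<ᵇ_; NonZero) renaming (_⊔_ to _⊔ℕ_; _*_ to _*ℕ_; _∸_ to _∸ℕ_)
open import Data.Nat.DivMod using (_/_)
open import Data.Nat.Combinatorics using (_C_)
open import Data.List using (List; []; _∷_; [_]; map; foldr; length; upTo; concatMap; _++_; null) renaming (filterᵇ to filter)
open import Data.Bool.ListAction using (any; all)
open import Data.Product using (_×_; _,_; proj₁; proj₂)
open import Relation.Nullary using (¬_)
open import Relation.Binary.PropositionalEquality using (_≡_)
open import Algebra.Bundles using (CommutativeRing; Semiring)
open import Data.Empty using (⊥)
import Algebra.Definitions.RawSemiring as RS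
open import Relation.Nullary.Decidable using (does)

-- A noncrossing partition of [n] is represented by its
-- restricted growth string (RGS): a list s of length n (positions
-- 0..n-1 stand for 1..n), s_i = label of the block of i, blocks
-- labelled 0,1,2,... in order of their minima.  This is exactly the
-- standard representative, so equal partitions have equal codes.

Code : Set
Code = List ℕ

-- the i-th entry (default 0 when out of range; never used that way)
at : Code → ℕ → ℕ
at []       _       = 0
at (x ∷ xs) zero    = x
at (x ∷ xs) (suc i) = at xs i

-- restricted growth check (m = number of labels used so far)
rgsFrom : ℕ → Code → Bool
rgsFrom m []       = true
rgsFrom m (a ∷ xs) = (a ≤ᵇ m) ∧ rgsFrom (m ⊔ℕ suc a) xs

crossing : Code → Bool
crossing s =
  any (λ a → any (λ c → any (λ b → any (λ d →
        (a <ᵇ c) ∧ (c <ᵇ b) ∧ (b <ᵇ d)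
        ∧ (at s a ≡ᵇ at s b) ∧ (at s c ≡ᵇ at s d)
        ∧ not (at s a ≡ᵇ at s c)) ps) ps) ps) ps
  where ps = upTo (length s)

isNCP : Code → Bool
isNCP []       = false
isNCP s@(_ ∷ _) = rgsFrom 0 s ∧ not (crossing s)

genRGS : ℕ → ℕ → List Code
genRGS zero    m = [ [] ]
genRGS (suc k) m = concatMap (λ a → map (a ∷_) (genRGS k (m ⊔ℕ suc a))) (upTo (suc m))

allNCP : ℕ → List Code
allNCP n = filter (λ s → not (crossing s)) (genRGS n 0)

maxL : Code → ℕ
maxL = foldr _⊔ℕ_ 0

nblocks : Code → ℕ
nblocks []         = 0
nblocks s@(_ ∷ _)  = suc (maxL s)

blockOf : Code → ℕ → List ℕ
blockOf s b = filter (λ i → at s i ≡ᵇ b) (upTo (length s))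

blocks : Code → List (List ℕ)
blocks s = map (blockOf s) (upTo (nblocks s))

firstOcc : List ℕ → List ℕ
firstOcc = Data.List.deduplicate Data.Nat._≟_

indexOf : ℕ → List ℕ → ℕ
indexOf x []       = 0
indexOf x (y ∷ ys) = if x ≡ᵇ y then 0 else suc (indexOf x ys)

std : List ℕ → Code
std xs = map (λ x → indexOf x (firstOcc xs)) xs

-- restriction P_{|X} (X an increasing list of positions), standardized
restrict : Code → List ℕ → Code
restrict s X = std (map (at s) X)

headL : List ℕ → ℕ
headL []      = 0
headL (x ∷ _) = x

lastL : List ℕ → ℕ
lastL []           = 0
lastL (x ∷ [])     = x
lastL (_ ∷ y ∷ ys) = lastL (y ∷ ys)

arrow : List ℕ → List ℕ → Bool
arrow π ρ = any (λ x → (headL π ≤ᵇ x) ∧ (x ≤ᵇ lastL π)) ρ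

subsets : ℕ → List (List Bool)
subsets zero    = [ [] ]
subsets (suc k) = concatMap (λ bs → (false ∷ bs) ∷ (true ∷ bs) ∷ []) (subsets k)

bit : List Bool → ℕ → Bool
bit []       _       = false
bit (b ∷ bs) zero    = b
bit (b ∷ bs) (suc i) = bit bs i

-- L (given by bits on block labels) is a lowerset:
-- ρ ∈ L and π → ρ imply π ∈ L
isLowerset : Code → List Bool → Bool
isLowerset s bs =
  all (λ j → not (bit bs j) ∨
        all (λ i → not (arrow (blockOf s i) (blockOf s j)) ∨ bit bs i) ls) ls
  where ls = upTo (nblocks s)

-- the gaps D_0,...,D_k determined by the positions of ⋃L
consHead : ℕ → List (List ℕ) → List (List ℕ)
consHead i []       = [ [ i ] ]
consHead i (g ∷ gs) = (i ∷ g) ∷ gs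

splitGaps : List (ℕ × Bool) → List (List ℕ)
splitGaps []               = [ [] ]
splitGaps ((i , true) ∷ xs)  = [] ∷ splitGaps xs
splitGaps ((i , false) ∷ xs) = consHead i (splitGaps xs)

-- a cut (L,U) of P, given by the bits of L, produces:
--  * whether the block containing the first element (label 0) is in L,
--  * the "L" word: [P_{|⋃L}] or [] if L is empty,
--  * the reduced gap monomial.
cutTerm : Code → List Bool → Bool × List Code × List Code
cutTerm s bs = bit bs 0 , Lw , Mw
  where
    inL : ℕ → Bool
    inL i = bit bs (at s i)
    pos = upTo (length s)
    U = filter inL pos
    Lw = if null U then [] else [ restrict s U ]
    Mw = map (restrict s) (filter (λ g → not (null g)) (splitGaps (map (λ i → i , inL i) pos)))

cutsP : Code → List (Bool × List Code × List Code)
cutsP s = map (cutTerm s) (filter (isLowerset s) (subsets (nblocks s)))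

-- all cuts of a word P_1⋯P_r, as terms L_1⋯L_r ⊗ M_1⋯M_r
cutsW : List Code → List (List Code × List Code)
cutsW []      = [ ([] , []) ]
cutsW (s ∷ w) = concatMap (λ t → map (λ lm → (proj₁ (proj₂ t) ++ proj₁ lm , proj₂ (proj₂ t) ++ proj₂ lm)) (cutsW w)) (cutsP s)

-- Δ_≺ : cuts where the block of 1 in P_1 is in L_1
deltaPrec : List Code → List (List Code × List Code)
deltaPrec []      = []
deltaPrec (s ∷ w) = concatMap (λ t → map (λ lm → (proj₁ (proj₂ t) ++ proj₁ lm , proj₂ (proj₂ t) ++ proj₂ lm)) (cutsW w))
                      (filter (λ t → proj₁ t) (cutsP s))

coarser : Code → Code → Bool
coarser p q = all (λ i → all (λ j → not (at p i ≡ᵇ at p j) ∨ (at q i ≡ᵇ at q j)) ps) ps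
  where ps = upTo (length p)

J : ℕ → Code
J n = upTo n

cat : (n : ℕ) → .{{_ : NonZero n}} → ℕ
cat n = ((2 *ℕ n ∸ℕ 2) C (n ∸ℕ 1)) / n

module OverRing {c ℓ} (K : CommutativeRing c ℓ) where
  open CommutativeRing K
  open RS (Semiring.rawSemiring semiring) using (_^_) renaming (_×_ to _·ℕ_) public

  record IsFieldChar0 : Set (c ⊔ ℓ) where
    field
      nontrivial : ¬ (1# ≈ 0#)
      inverses   : ∀ x → ¬ (x ≈ 0#) → Data.Product.Σ Carrier (λ y → x * y ≈ 1#)
      char0      : ∀ n → ¬ (suc n ·ℕ 1# ≈ 0#)

  sumK : List Carrier → Carrier
  sumK = foldr _+_ 0#

  prodK : List Carrier → Carrier
  prodK = foldr _*_ 1#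

  -- linear forms on H = functions on words (basis)
  -- counit ε_H
  εH : List Code → Carrier
  εH []      = 1#
  εH (_ ∷ _) = 0#

  e : List Code → Carrier
  e (P ∷ []) = if nblocks P ≡ᵇ 1 then 1# else 0#
  e _        = 0#

  prec : (List Code → Carrier) → (List Code → Carrier) → List Code → Carrier
  prec f g []        = 0#
  prec f g w@(_ ∷ _) = sumK (map (λ lm → f (proj₁ lm) * g (proj₂ lm)) (deltaPrec w))

  -- characters of A are determined by their values on NCP;
  -- convolution (φ * ψ)(P) = Σ_{Q ≥ P} φ(Q) ∏_{τ ∈ Q} ψ(P_{|τ})
  conv : (Code → Carrier) → (Code → Carrier) → Code → Carrier
  conv φ ψ p = sumK (map (λ q → φ q * prodK (map (λ τ → ψ (restrict p τ)) (blocks q)))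
                         (filter (coarser p) (allNCP (length p))))

  unitA : Code → Carrier
  unitA p = if nblocks p ≡ᵇ 1 then 1# else 0#

  signedCat : (n : ℕ) → .{{_ : NonZero n}} → Carrier
  signedCat n = ((- 1#) ^ suc n) * (cat n ·ℕ 1#)

module Submission where

-- ψ_≺ is identically 1 on words of noncrossing partitions: in
-- (e ≺ ψ)(P₁⋯P_r) the factor e kills every cut except the one whose lowerset is
-- the block of 1 in P₁ alone and empty in the other letters (e vanishes on
-- words of length ≥ 2 and on partitions with several blocks), so ψ(w) = ψ(w')
-- for a word w' of smaller total size.  Hence (ψ̄ * χ)(J_m) is the sum over
-- Q ∈ NCP(m) of ∏_{τ ∈ Q} f |τ| with f k = χ(J_k), which is 1 for m = 1 and 0
-- for m ≥ 2.  Let G_j(m) be the same sum with the size of the block of 1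
-- shifted by j.  Splitting Q at its block of 1 into a nested part C and a rest
-- D (whose block of 1 is merged with {1}) gives
-- G_j(m + 2) = G_{j+1}(m + 1) + G_{j+1}(m), and this two-index recurrence is
-- solved by the signed ballot numbers (-1)^(i+m) (C(m+2i, i) - C(m+2i, i-1)),
-- whose value at m = 0 is f (i + 1) = (-1)^i cat_(i+1).

open import Defs
open import Data.Nat using (ℕ; suc; NonZero)
open import Data.Bool using (T)
open import Data.List using (List; [_])
open import Data.List.Relation.Unary.All using (All)
open import Algebra.Bundles using (CommutativeRing)

module BooleanReflection where

  open import Data.Nat using (ℕ; zero; suc; _<_; z≤n; s≤s; _≡ᵇ_; _<ᵇ_)
  open import Data.Nat.Properties
  open import Data.Bool using (Bool; true; false; _∧_; _∨_; not; T)
  open import Data.List using (length; upTo; applyUpTo)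
  open import Data.Bool.ListAction using (any; all)
  open import Data.Product using (Σ; _×_; _,_)
  open import Data.Sum using (_⊎_; inj₁; inj₂)
  open import Data.Unit using (tt)
  open import Relation.Nullary using (¬_)
  open import Relation.Binary.PropositionalEquality using (_≡_; _≢_)
  open import Function using (_∘_; id)

  T-∧⁺ : ∀ {x y} → T x → T y → T (x ∧ y)
  T-∧⁺ {true} {true} _ _ = tt

  T-∧⁻ˡ : ∀ {x y} → T (x ∧ y) → T x
  T-∧⁻ˡ {true} _ = tt

  T-∧⁻ʳ : ∀ {x y} → T (x ∧ y) → T y
  T-∧⁻ʳ {true} p = p

  T-∨⁺ˡ : ∀ {x y} → T x → T (x ∨ y)
  T-∨⁺ˡ {true} _ = tt

  T-∨⁺ʳ : ∀ {x y} → T y → T (x ∨ y)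
  T-∨⁺ʳ {true} _ = tt
  T-∨⁺ʳ {false} p = p

  T-∨⁻ : ∀ {x y} → T (x ∨ y) → T x ⊎ T y
  T-∨⁻ {true} _ = inj₁ tt
  T-∨⁻ {false} p = inj₂ p

  T-not⁺ : ∀ {x} → ¬ T x → T (not x)
  T-not⁺ {false} _ = tt
  T-not⁺ {true} n = n tt

  T-not⁻ : ∀ {x} → T (not x) → ¬ T x
  T-not⁻ {false} _ ()
  T-not⁻ {true} ()

  ≡ᵇ⇒ : ∀ {m n} → T (m ≡ᵇ n) → m ≡ n
  ≡ᵇ⇒ {m} {n} = ≡ᵇ⇒≡ m n

  ⇒≡ᵇ : ∀ {m n} → m ≡ n → T (m ≡ᵇ n)
  ⇒≡ᵇ {m} {n} = ≡⇒≡ᵇ m n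

  <ᵇ⇒ : ∀ {m n} → T (m <ᵇ n) → m < n
  <ᵇ⇒ {m} {n} = <ᵇ⇒< m n

  any-app⁻ : ∀ (p : ℕ → Bool) (f : ℕ → ℕ) n → T (any p (applyUpTo f n)) → Σ ℕ λ i → i < n × T (p (f i))
  any-app⁻ p f zero ()
  any-app⁻ p f (suc n) h with T-∨⁻ {p (f 0)} h
  ... | inj₁ q = 0 , s≤s z≤n , q
  ... | inj₂ q with any-app⁻ p (f ∘ suc) n q
  ... | i , i<n , r = suc i , s≤s i<n , r

  any-app⁺ : ∀ (p : ℕ → Bool) (f : ℕ → ℕ) n i → i < n → T (p (f i)) → T (any p (applyUpTo f n))
  any-app⁺ p f (suc n) zero _ q = T-∨⁺ˡ q
  any-app⁺ p f (suc n) (suc i) (s≤s i<n) q = T-∨⁺ʳ {p (f 0)} (any-app⁺ p (f ∘ suc) n i i<n q)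

  any-upTo⁻ : ∀ (p : ℕ → Bool) n → T (any p (upTo n)) → Σ ℕ λ i → i < n × T (p i)
  any-upTo⁻ p n = any-app⁻ p id n

  any-upTo⁺ : ∀ (p : ℕ → Bool) n i → i < n → T (p i) → T (any p (upTo n))
  any-upTo⁺ p n = any-app⁺ p id n

  all-app⁺ : ∀ (p : ℕ → Bool) (f : ℕ → ℕ) n → (∀ i → i < n → T (p (f i))) → T (all p (applyUpTo f n))
  all-app⁺ p f zero h = tt
  all-app⁺ p f (suc n) h = T-∧⁺ (h 0 (s≤s z≤n)) (all-app⁺ p (f ∘ suc) n (λ i i<n → h (suc i) (s≤s i<n)))

  all-upTo⁺ : ∀ (p : ℕ → Bool) n → (∀ i → i < n → T (p i)) → T (all p (upTo n))
  all-upTo⁺ p n = all-app⁺ p id n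

  Crossing : Code → Set
  Crossing s = Σ ℕ λ a → Σ ℕ λ c → Σ ℕ λ b → Σ ℕ λ d →
    a < c × c < b × b < d × d < length s × at s a ≡ at s b × at s c ≡ at s d × at s a ≢ at s c

  T-crossingTest⁻ : ∀ x1 x2 x3 x4 x5 x6 → T (x1 ∧ x2 ∧ x3 ∧ x4 ∧ x5 ∧ not x6) → T x1 × T x2 × T x3 × T x4 × T x5 × ¬ T x6
  T-crossingTest⁻ true true true true true false _ = tt , tt , tt , tt , tt , λ ()

  crossing⇒Crossing : ∀ s → T (crossing s) → Crossing s
  crossing⇒Crossing s h =
    let n = length s
        (a , _ , h1) = any-upTo⁻ _ n h
        (c , _ , h2) = any-upTo⁻ _ n h1
        (b , _ , h3) = any-upTo⁻ _ n h2
        (d , d<n , h4) = any-upTo⁻ _ n h3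
        (q1 , q2 , q3 , q4 , q5 , q6) = T-crossingTest⁻ (a <ᵇ c) (c <ᵇ b) (b <ᵇ d) (at s a ≡ᵇ at s b) (at s c ≡ᵇ at s d) (at s a ≡ᵇ at s c) h4
    in a , c , b , d , <ᵇ⇒ q1 , <ᵇ⇒ q2 , <ᵇ⇒ q3 , d<n , ≡ᵇ⇒ q4 , ≡ᵇ⇒ q5 , (λ e → q6 (⇒≡ᵇ e))

  Crossing⇒crossing : ∀ s → Crossing s → T (crossing s)
  Crossing⇒crossing s (a , c , b , d , a<c , c<b , b<d , d<n , e1 , e2 , ne) =
    any-upTo⁺ _ n a a<n (any-upTo⁺ _ n c c<n (any-upTo⁺ _ n b b<n (any-upTo⁺ _ n d d<n
      (T-∧⁺ (<⇒<ᵇ a<c) (T-∧⁺ (<⇒<ᵇ c<b) (T-∧⁺ (<⇒<ᵇ b<d) (T-∧⁺ (⇒≡ᵇ e1) (T-∧⁺ (⇒≡ᵇ e2)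
        (T-not⁺ (λ t → ne (≡ᵇ⇒ t)))))))))))
    where
      n = length s
      b<n = <-trans b<d d<n
      c<n = <-trans c<b b<n
      a<n = <-trans a<c c<n

module Glueing where

  open BooleanReflection
  open import Data.Nat using (ℕ; zero; suc; _+_; _∸_; _≤_; _<_; _<?_; z≤n; s≤s; z<s; s<s; _≤ᵇ_; _⊔_)
  open import Data.Nat.Properties
  open import Data.Bool using (true; false; _∧_; T)
  open import Data.List using (List; []; _∷_; map; length; _++_)
  open import Data.List.Properties using (length-map; length-++; ∷-injectiveˡ; ∷-injectiveʳ)
  open import Data.Product using (Σ; _×_; _,_; proj₁; proj₂)
  open import Data.Sum using (_⊎_; inj₁; inj₂)
  open import Data.Empty using (⊥; ⊥-elim)
  open import Data.Unit using (tt)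
  open import Relation.Nullary using (¬_; yes; no)
  open import Relation.Binary.PropositionalEquality using (_≡_; refl; sym; trans; cong; cong₂; subst; _≢_)
  open import Function using (_∘_)

  at-++ˡ : ∀ (xs ys : List ℕ) i → i < length xs → at (xs ++ ys) i ≡ at xs i
  at-++ˡ (x ∷ xs) ys zero _ = refl
  at-++ˡ (x ∷ xs) ys (suc i) (s≤s p) = at-++ˡ xs ys i p

  at-++ʳ : ∀ (xs ys : List ℕ) j → at (xs ++ ys) (length xs + j) ≡ at ys j
  at-++ʳ [] ys j = refl
  at-++ʳ (x ∷ xs) ys j = at-++ʳ xs ys j

  at-map : ∀ (f : ℕ → ℕ) (xs : List ℕ) i → i < length xs → at (map f xs) i ≡ f (at xs i)
  at-map f (x ∷ xs) zero _ = refl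
  at-map f (x ∷ xs) (suc i) (s≤s p) = at-map f xs i p

  at-map0 : ∀ (f : ℕ → ℕ) → f 0 ≡ 0 → (xs : List ℕ) → ∀ i → at (map f xs) i ≡ f (at xs i)
  at-map0 f f0 [] i = sym f0
  at-map0 f f0 (x ∷ xs) zero = refl
  at-map0 f f0 (x ∷ xs) (suc i) = at-map0 f f0 xs i

  at≤maxL : ∀ (xs : List ℕ) i → at xs i ≤ maxL xs
  at≤maxL [] i = z≤n
  at≤maxL (x ∷ xs) zero = m≤m⊔n x (maxL xs)
  at≤maxL (x ∷ xs) (suc i) = ≤-trans (at≤maxL xs i) (m≤n⊔m x (maxL xs))

  labelsAfter : ℕ → List ℕ → ℕ
  labelsAfter m [] = m
  labelsAfter m (a ∷ xs) = labelsAfter (m ⊔ suc a) xs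

  rgs-++ : ∀ m (xs ys : List ℕ) → rgsFrom m (xs ++ ys) ≡ (rgsFrom m xs ∧ rgsFrom (labelsAfter m xs) ys)
  rgs-++ m [] ys = refl
  rgs-++ m (a ∷ xs) ys with a ≤ᵇ m
  ... | true = rgs-++ (m ⊔ suc a) xs ys
  ... | false = refl

  rgs-++₁ : ∀ m (xs ys : List ℕ) → T (rgsFrom m (xs ++ ys)) → T (rgsFrom m xs)
  rgs-++₁ m xs ys h = T-∧⁻ˡ (subst T (rgs-++ m xs ys) h)

  rgs-++₂ : ∀ m (xs ys : List ℕ) → T (rgsFrom m (xs ++ ys)) → T (rgsFrom (labelsAfter m xs) ys)
  rgs-++₂ m xs ys h = T-∧⁻ʳ {rgsFrom m xs} (subst T (rgs-++ m xs ys) h)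

  rgs-++⁺ : ∀ m (xs ys : List ℕ) → T (rgsFrom m xs) → T (rgsFrom (labelsAfter m xs) ys) → T (rgsFrom m (xs ++ ys))
  rgs-++⁺ m xs ys h1 h2 = subst T (sym (rgs-++ m xs ys)) (T-∧⁺ h1 h2)

  ≤ᵇ-suc : ∀ a m → (suc a ≤ᵇ suc m) ≡ (a ≤ᵇ m)
  ≤ᵇ-suc zero m = refl
  ≤ᵇ-suc (suc a) m = refl

  rgs-suc : ∀ m (xs : List ℕ) → rgsFrom (suc m) (map suc xs) ≡ rgsFrom m xs
  rgs-suc m [] = refl
  rgs-suc m (a ∷ xs) = cong₂ _∧_ (≤ᵇ-suc a m) (rgs-suc (m ⊔ suc a) xs)

  labelsAfter-suc : ∀ m (xs : List ℕ) → labelsAfter (suc m) (map suc xs) ≡ suc (labelsAfter m xs)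
  labelsAfter-suc m [] = refl
  labelsAfter-suc m (a ∷ xs) = labelsAfter-suc (m ⊔ suc a) xs

  labelsAfter≡⊔nblocks : ∀ m (xs : List ℕ) → labelsAfter m xs ≡ m ⊔ nblocks xs
  labelsAfter≡⊔nblocks m [] = sym (⊔-identityʳ m)
  labelsAfter≡⊔nblocks m (a ∷ []) = cong (λ t → m ⊔ suc t) (sym (⊔-identityʳ a))
  labelsAfter≡⊔nblocks m (a ∷ b ∷ xs) = trans (labelsAfter≡⊔nblocks (m ⊔ suc a) (b ∷ xs)) (⊔-assoc m (suc a) (suc (b ⊔ maxL xs)))

  labelsAfter-0 : ∀ (xs : List ℕ) → labelsAfter 0 xs ≡ nblocks xs
  labelsAfter-0 xs = labelsAfter≡⊔nblocks 0 xs

  shift : ℕ → ℕ → ℕ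
  shift k zero = zero
  shift k (suc x) = suc x + k

  unshift : ℕ → ℕ → ℕ
  unshift k zero = zero
  unshift k (suc x) = suc x ∸ k

  shift-injective : ∀ k x y → shift k x ≡ shift k y → x ≡ y
  shift-injective k zero zero e = refl
  shift-injective k (suc x) (suc y) e = +-cancelʳ-≡ k (suc x) (suc y) e

  shift-unshift : ∀ k y → (y ≡ 0 ⊎ k < y) → shift k (unshift k y) ≡ y
  shift-unshift k zero _ = refl
  shift-unshift k (suc y) (inj₁ ())
  shift-unshift k (suc y) (inj₂ k<y) with suc y ∸ k in eq
  ... | zero = ⊥-elim (<⇒≢ (≤-trans k<y (≤-reflexive refl)) (sym (trans (sym (m∸n+n≡m (<⇒≤ k<y))) (cong (_+ k) eq))))
  ... | suc z = trans (cong (_+ k) (sym eq)) (m∸n+n≡m (<⇒≤ k<y))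

  rgs-shift : ∀ s k (xs : List ℕ) → 1 ≤ s → rgsFrom (s + k) (map (shift k) xs) ≡ rgsFrom s xs
  rgs-shift s k [] _ = refl
  rgs-shift s k (zero ∷ xs) s≥1 =
    trans (cong (λ t → rgsFrom t (map (shift k) xs)) (m≥n⇒m⊔n≡m (≤-trans s≥1 (m≤m+n s k))))
     (trans (rgs-shift s k xs s≥1) (cong (λ t → rgsFrom t xs) (sym (m≥n⇒m⊔n≡m s≥1))))
  rgs-shift s k (suc a ∷ xs) s≥1 with suc a ≤ᵇ s in eq
  ... | true = trans (cong (λ b → b ∧ rgsFrom ((s + k) ⊔ suc (suc a + k)) (map (shift k) xs)) (lem1 eq))
              (trans (cong (λ t → rgsFrom t (map (shift k) xs)) lem2) (rgs-shift (s ⊔ suc (suc a)) k xs (≤-trans s≥1 (m≤m⊔n s _))))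
    where
      lem1 : (suc a ≤ᵇ s) ≡ true → (suc a + k ≤ᵇ s + k) ≡ true
      lem1 e with suc a + k ≤ᵇ s + k in e2
      ... | true = refl
      ... | false = ⊥-elim (subst T e2 (≤⇒≤ᵇ (+-monoˡ-≤ k (≤ᵇ⇒≤ (suc a) s (subst T (sym e) tt)))))
      lem2 : (s + k) ⊔ suc (suc a + k) ≡ (s ⊔ suc (suc a)) + k
      lem2 = sym (+-distribʳ-⊔ k s (suc (suc a)))
  ... | false with suc a + k ≤ᵇ s + k in e2
  ... | true = ⊥-elim (subst T eq (≤⇒≤ᵇ (+-cancelʳ-≤ k (suc a) s (≤ᵇ⇒≤ (suc a + k) (s + k) (subst T (sym e2) tt)))))
  ... | false = refl

  rgs-head : ∀ m a (xs : List ℕ) → T (rgsFrom m (a ∷ xs)) → a ≤ m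
  rgs-head m a xs h = ≤ᵇ⇒≤ a m (T-∧⁻ˡ h)

  rgs-tail : ∀ m a (xs : List ℕ) → T (rgsFrom m (a ∷ xs)) → T (rgsFrom (m ⊔ suc a) xs)
  rgs-tail m a xs h = T-∧⁻ʳ {a ≤ᵇ m} h

  rgs-labelOccurs : ∀ m (xs : List ℕ) y → T (rgsFrom m xs) → m ≤ y → y < labelsAfter m xs → Σ ℕ λ i → i < length xs × at xs i ≡ y
  rgs-labelOccurs m [] y h m≤y y< = ⊥-elim (<-irrefl refl (≤-<-trans m≤y y<))
  rgs-labelOccurs m (a ∷ xs) y h m≤y y< with y <? (m ⊔ suc a)
  ... | no ¬p = let (i , i< , e) = rgs-labelOccurs (m ⊔ suc a) xs y (rgs-tail m a xs h) (≮⇒≥ ¬p) y< in suc i , s≤s i< , e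
  ... | yes p with m≤n⇒m<n∨m≡n (rgs-head m a xs h)
  ...   | inj₁ a<m = ⊥-elim (<-irrefl refl (≤-<-trans m≤y (subst (y <_) (m≥n⇒m⊔n≡m a<m) p)))
  ...   | inj₂ refl = 0 , s≤s z≤n , ≤-antisym m≤y (≤-pred (subst (y <_) (m≤n⇒m⊔n≡n (n≤1+n a)) p))

  -- glue C D is 1, then C nested under it, then D with the block of its first
  -- element merged into the block of 1; the remaining labels of D are shifted
  -- past those of C.
  glue : Code → Code → Code
  glue C D = 0 ∷ (map suc C ++ map (shift (nblocks C)) D)

  ZeroHeaded : List ℕ → Set
  ZeroHeaded E = E ≡ [] ⊎ Σ (List ℕ) λ E' → E ≡ 0 ∷ E'

  splitAtZero : List ℕ → List ℕ × List ℕ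
  splitAtZero [] = [] , []
  splitAtZero (zero ∷ xs) = [] , zero ∷ xs
  splitAtZero (suc y ∷ xs) = y ∷ proj₁ (splitAtZero xs) , proj₂ (splitAtZero xs)

  splitAtZero-++ : ∀ xs → map suc (proj₁ (splitAtZero xs)) ++ proj₂ (splitAtZero xs) ≡ xs
  splitAtZero-++ [] = refl
  splitAtZero-++ (zero ∷ xs) = refl
  splitAtZero-++ (suc y ∷ xs) = cong (suc y ∷_) (splitAtZero-++ xs)

  splitAtZero-ZeroHeaded : ∀ xs → ZeroHeaded (proj₂ (splitAtZero xs))
  splitAtZero-ZeroHeaded [] = inj₁ refl
  splitAtZero-ZeroHeaded (zero ∷ xs) = inj₂ (xs , refl)
  splitAtZero-ZeroHeaded (suc y ∷ xs) = splitAtZero-ZeroHeaded xs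

  splitAtZero-glued : ∀ C E → ZeroHeaded E → splitAtZero (map suc C ++ E) ≡ (C , E)
  splitAtZero-glued [] .[] (inj₁ refl) = refl
  splitAtZero-glued [] .(0 ∷ E') (inj₂ (E' , refl)) = refl
  splitAtZero-glued (c ∷ C) E z rewrite splitAtZero-glued C E z = refl

  ZeroHeaded-shift : ∀ k D → ZeroHeaded D → ZeroHeaded (map (shift k) D)
  ZeroHeaded-shift k .[] (inj₁ refl) = inj₁ refl
  ZeroHeaded-shift k .(0 ∷ E') (inj₂ (E' , refl)) = inj₂ (map (shift k) E' , refl)

  ZeroHeaded-rgs : ∀ D → T (rgsFrom 0 D) → ZeroHeaded D
  ZeroHeaded-rgs [] _ = inj₁ refl
  ZeroHeaded-rgs (zero ∷ D) _ = inj₂ (D , refl)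
  ZeroHeaded-rgs (suc a ∷ D) ()

  map-inj : ∀ (f : ℕ → ℕ) → (∀ x y → f x ≡ f y → x ≡ y) → ∀ xs ys → map f xs ≡ map f ys → xs ≡ ys
  map-inj f inj [] [] e = refl
  map-inj f inj (x ∷ xs) (y ∷ ys) e = cong₂ _∷_ (inj x y (∷-injectiveˡ e)) (map-inj f inj xs ys (∷-injectiveʳ e))

  glue-injective : ∀ C D C' D' → ZeroHeaded D → ZeroHeaded D' → glue C D ≡ glue C' D' → C ≡ C' × D ≡ D'
  glue-injective C D C' D' z z' e =
    let e1 = trans (sym (splitAtZero-glued C (map (shift (nblocks C)) D) (ZeroHeaded-shift _ D z)))
               (trans (cong (splitAtZero ∘ tl) e) (splitAtZero-glued C' (map (shift (nblocks C')) D') (ZeroHeaded-shift _ D' z')))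
        eC = cong proj₁ e1
        eD = cong proj₂ e1
    in eC , map-inj (shift (nblocks C)) (shift-injective (nblocks C)) D D' (trans eD (cong (λ t → map (shift (nblocks t)) D') (sym eC)))
    where
      tl : List ℕ → List ℕ
      tl [] = []
      tl (_ ∷ xs) = xs

  length-glue : ∀ C D → length (glue C D) ≡ suc (length C + length D)
  length-glue C D = cong suc (trans (length-++ (map suc C)) (cong₂ _+_ (length-map suc C) (length-map _ D)))

  suc-at≤nblocks : ∀ (C : List ℕ) p → p < length (map suc C) → suc (at C p) ≤ nblocks C
  suc-at≤nblocks [] p ()
  suc-at≤nblocks (x ∷ xs) p _ = s≤s (at≤maxL (x ∷ xs) p)

  module GlueLayout (C D : Code) where
    k = nblocks C
    lC = length (map suc C)
    lD = length D
    q = glue C D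

    length-glued : length q ≡ suc (lC + lD)
    length-glued = cong suc (trans (length-++ (map suc C)) (cong (lC +_) (length-map _ D)))

    at-left : ∀ p → p < lC → at q (suc p) ≡ suc (at C p)
    at-left p p< = trans (at-++ˡ (map suc C) _ p p<) (at-map suc C p (subst (p <_) (length-map suc C) p<))

    at-right : ∀ j → at q (suc (lC + j)) ≡ shift k (at D j)
    at-right j = trans (at-++ʳ (map suc C) _ j) (at-map0 (shift k) refl D j)

    left-label< : ∀ p → p < lC → suc (at C p) ≤ k
    left-label< = suc-at≤nblocks C

    left≢right : ∀ p y → p < lC → suc (at C p) ≢ shift k y
    left≢right p zero p< ()
    left≢right p (suc y) p< e = <-irrefl refl (<-≤-trans (m<n+m k {suc y} z<s) (≤-trans (≤-reflexive (sym e)) (left-label< p p<)))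

    positionView : ∀ i → i < suc (lC + lD) → i ≡ 0 ⊎ (Σ ℕ λ p → p < lC × i ≡ suc p) ⊎ (Σ ℕ λ j → j < lD × i ≡ suc (lC + j))
    positionView zero _ = inj₁ refl
    positionView (suc i) (s≤s i<) with i <? lC
    ... | yes p = inj₂ (inj₁ (i , p , refl))
    ... | no np = inj₂ (inj₂ (i ∸ lC , +-cancelˡ-< lC (i ∸ lC) lD (subst (_< lC + lD) (sym (m+[n∸m]≡n (≮⇒≥ np))) i<) , cong suc (sym (m+[n∸m]≡n (≮⇒≥ np)))))

    <length-glued : ∀ i → i < suc (lC + lD) → i < length q
    <length-glued i p = subst (i <_) (sym length-glued) p

    <length-glued⁻ : ∀ i → i < length q → i < suc (lC + lD)
    <length-glued⁻ i p = subst (i <_) length-glued p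

    right-order⁻ : ∀ x y → suc (lC + x) < suc (lC + y) → x < y
    right-order⁻ x y p = +-cancelˡ-< lC x y (≤-pred p)

    right-order⁺ : ∀ x y → x < y → suc (lC + x) < suc (lC + y)
    right-order⁺ x y p = s<s (+-monoʳ-< lC p)

    ¬right<left : ∀ x p → p < lC → suc (lC + x) < suc p → ⊥
    ¬right<left x p p< h = <-irrefl refl (<-≤-trans (<-trans (≤-pred h) p<) (m≤m+n lC x))

    lC≡length : lC ≡ length C
    lC≡length = length-map suc C

    Crossing-glueˡ : Crossing C → Crossing q
    Crossing-glueˡ (a , c , b , d , a<c , c<b , b<d , d<n , e1 , e2 , ne) =
      suc a , suc c , suc b , suc d , s<s a<c , s<s c<b , s<s b<d , <length-glued (suc d) (s<s (≤-trans dl (m≤m+n lC lD))) ,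
      trans (at-left a al) (trans (cong suc e1) (sym (at-left b bl))) ,
      trans (at-left c cl) (trans (cong suc e2) (sym (at-left d dl))) ,
      (λ e → ne (suc-injective (trans (sym (at-left a al)) (trans e (at-left c cl)))))
      where
        dl : d < lC
        dl = subst (d <_) (sym lC≡length) d<n
        bl = <-trans b<d dl
        cl = <-trans c<b bl
        al = <-trans a<c cl

    Crossing-glueʳ : Crossing D → Crossing q
    Crossing-glueʳ (a , c , b , d , a<c , c<b , b<d , d<n , e1 , e2 , ne) =
      suc (lC + a) , suc (lC + c) , suc (lC + b) , suc (lC + d) , right-order⁺ a c a<c , right-order⁺ c b c<b , right-order⁺ b d b<d ,
      <length-glued (suc (lC + d)) (s<s (+-monoʳ-< lC d<n)) ,
      trans (at-right a) (trans (cong (shift k) e1) (sym (at-right b))) ,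
      trans (at-right c) (trans (cong (shift k) e2) (sym (at-right d))) ,
      (λ e → ne (shift-injective k _ _ (trans (sym (at-right a)) (trans e (at-right c)))))

    shift≡0 : ∀ y → shift k y ≡ 0 → y ≡ 0
    shift≡0 zero _ = refl
    shift≡0 (suc y) ()

    Crossing-glue⁻ : ZeroHeaded D → Crossing q → Crossing C ⊎ Crossing D
    Crossing-glue⁻ z (a , c , b , d , a<c , c<b , b<d , d<n , e1 , e2 , ne)
      with positionView b (<length-glued⁻ b (<-trans b<d d<n)) | positionView d (<length-glued⁻ d d<n)
    ... | inj₁ refl | _ = ⊥-elim (<-irrefl refl (<-≤-trans a<c (≤-trans (<⇒≤ c<b) z≤n)))
    ... | _ | inj₁ refl = ⊥-elim (<-irrefl refl (≤-trans b<d z≤n))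
    ... | inj₂ (inj₁ (pb , pb< , refl)) | dv with positionView a (<length-glued⁻ a (<-trans a<c (<-trans c<b (<-trans b<d d<n))))
    ...   | inj₁ refl = ⊥-elim (0≢suc (trans e1 (at-left pb pb<)))
      where 0≢suc : ∀ {n} → 0 ≢ suc n
            0≢suc ()
    ...   | inj₂ (inj₂ (ja , _ , refl)) = ⊥-elim (¬right<left ja pb pb< (<-trans a<c c<b))
    ...   | inj₂ (inj₁ (pa , pa< , refl)) with positionView c (<length-glued⁻ c (<-trans c<b (<-trans b<d d<n)))
    ...     | inj₁ refl = ⊥-elim (<-irrefl refl (≤-trans a<c z≤n))
    ...     | inj₂ (inj₂ (jc , _ , refl)) = ⊥-elim (¬right<left jc pb pb< c<b)
    ...     | inj₂ (inj₁ (pc , pc< , refl)) with dv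
    ...       | inj₁ refl = ⊥-elim (<-irrefl refl (≤-trans b<d z≤n))
    ...       | inj₂ (inj₂ (jd , _ , refl)) = ⊥-elim (left≢right pc (at D jd) pc< (trans (sym (at-left pc pc<)) (trans e2 (at-right jd))))
    ...       | inj₂ (inj₁ (pd , pd< , refl)) = inj₁ (pa , pc , pb , pd , ≤-pred a<c , ≤-pred c<b , ≤-pred b<d , subst (pd <_) lC≡length pd< ,
                    suc-injective (trans (sym (at-left pa pa<)) (trans e1 (at-left pb pb<))) ,
                    suc-injective (trans (sym (at-left pc pc<)) (trans e2 (at-left pd pd<))) ,
                    (λ e → ne (trans (at-left pa pa<) (trans (cong suc e) (sym (at-left pc pc<))))))
    Crossing-glue⁻ z (a , c , b , d , a<c , c<b , b<d , d<n , e1 , e2 , ne)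
        | inj₂ (inj₂ (jb , jb< , refl)) | inj₂ (inj₁ (pd , pd< , refl)) = ⊥-elim (¬right<left jb pd pd< b<d)
    Crossing-glue⁻ z (a , c , b , d , a<c , c<b , b<d , d<n , e1 , e2 , ne)
        | inj₂ (inj₂ (jb , jb< , refl)) | inj₂ (inj₂ (jd , jd< , refl))
        with positionView a (<length-glued⁻ a (<-trans a<c (<-trans c<b (<-trans b<d d<n))))
    ... | inj₂ (inj₁ (pa , pa< , refl)) = ⊥-elim (left≢right pa (at D jb) pa< (trans (sym (at-left pa pa<)) (trans e1 (at-right jb))))
    ... | inj₂ (inj₂ (ja , ja< , refl)) with positionView c (<length-glued⁻ c (<-trans c<b (<-trans b<d d<n)))
    ...   | inj₁ refl = ⊥-elim (<-irrefl refl (≤-trans a<c z≤n))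
    ...   | inj₂ (inj₁ (pc , pc< , refl)) = ⊥-elim (¬right<left ja pc pc< a<c)
    ...   | inj₂ (inj₂ (jc , jc< , refl)) = inj₂ (ja , jc , jb , jd , right-order⁻ ja jc a<c , right-order⁻ jc jb c<b , right-order⁻ jb jd b<d , jd< ,
                    shift-injective k _ _ (trans (sym (at-right ja)) (trans e1 (at-right jb))) ,
                    shift-injective k _ _ (trans (sym (at-right jc)) (trans e2 (at-right jd))) ,
                    (λ e → ne (trans (at-right ja) (trans (cong (shift k) e) (sym (at-right jc))))))
    Crossing-glue⁻ z (a , c , b , d , a<c , c<b , b<d , d<n , e1 , e2 , ne)
        | inj₂ (inj₂ (jb , jb< , refl)) | inj₂ (inj₂ (jd , jd< , refl))
        | inj₁ refl with positionView c (<length-glued⁻ c (<-trans c<b (<-trans b<d d<n)))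
    ...   | inj₁ refl = ⊥-elim (<-irrefl refl a<c)
    ...   | inj₂ (inj₁ (pc , pc< , refl)) = ⊥-elim (left≢right pc (at D jd) pc< (trans (sym (at-left pc pc<)) (trans e2 (at-right jd))))
    ...   | inj₂ (inj₂ (jc , jc< , refl)) with z
    ...     | inj₁ refl = ⊥-elim (<-irrefl refl (≤-trans jd< z≤n))
    ...     | inj₂ (D' , refl) = inj₂ (0 , jc , jb , jd , jc>0 , right-order⁻ jc jb c<b , right-order⁻ jb jd b<d , jd< ,
                    sym (shift≡0 (at D jb) (sym (trans e1 (at-right jb)))) ,
                    shift-injective k _ _ (trans (sym (at-right jc)) (trans e2 (at-right jd))) ,
                    (λ e → ne (trans (cong (shift k) e) (sym (at-right jc)))))
      where
        Dc≢0 : at D jc ≢ 0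
        Dc≢0 e = ne (sym (trans (at-right jc) (cong (shift k) e)))
        positiveIndex : ∀ j → at D j ≢ 0 → 0 < j
        positiveIndex zero h = ⊥-elim (h refl)
        positiveIndex (suc j) _ = z<s
        jc>0 : 0 < jc
        jc>0 = positiveIndex jc Dc≢0

  rgs-0⇒1 : ∀ D → T (rgsFrom 0 D) → T (rgsFrom 1 D)
  rgs-0⇒1 [] _ = tt
  rgs-0⇒1 (zero ∷ D) h = h

  rgs-glue : ∀ C D → T (rgsFrom 0 C) → T (rgsFrom 0 D) → T (rgsFrom 0 (glue C D))
  rgs-glue C D hC hD = rgs-++⁺ 1 (map suc C) (map (shift (nblocks C)) D)
    (subst T (sym (rgs-suc 0 C)) hC)
    (subst (λ t → T (rgsFrom t (map (shift (nblocks C)) D))) (sym (trans (labelsAfter-suc 0 C) (cong suc (labelsAfter-0 C))))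
      (subst T (sym (rgs-shift 1 (nblocks C) D (s≤s z≤n))) (rgs-0⇒1 D hD)))

  map-shift-unshift : ∀ k E → (∀ j → j < length E → at E j ≡ 0 ⊎ k < at E j) → map (shift k) (map (unshift k) E) ≡ E
  map-shift-unshift k [] h = refl
  map-shift-unshift k (y ∷ E) h = cong₂ _∷_ (shift-unshift k y (h 0 z<s)) (map-shift-unshift k E (λ j j< → h (suc j) (s<s j<)))

  -- A label of C reappearing after the second element of the block of 1 would
  -- cross that block.
  tailLabels-fresh : ∀ C E → T (rgsFrom 0 C) → ¬ Crossing (0 ∷ (map suc C ++ E)) → ZeroHeaded E →
    ∀ j → j < length E → at E j ≡ 0 ⊎ nblocks C < at E j
  tailLabels-fresh C E hC nc zh j j< with at E j in ej
  ... | zero = inj₁ refl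
  ... | suc y with nblocks C <? suc y
  ...   | yes p = inj₂ p
  ...   | no np with zh
  ...     | inj₁ refl = ⊥-elim (n≮0 j<)
  ...     | inj₂ (E' , refl) = ⊥-elim (nc crossesFirstBlock)
    where
      lC = length (map suc C)
      sj = rgs-labelOccurs 0 C y hC z≤n (subst (y <_) (sym (labelsAfter-0 C)) (≤-pred (≰⇒> np)))
      p = proj₁ sj
      p<C = proj₁ (proj₂ sj)
      p<lC : p < lC
      p<lC = subst (p <_) (sym (length-map suc C)) p<C
      0≢suc : ∀ {n} → 0 ≢ suc n
      0≢suc ()
      positive : ∀ i → at (0 ∷ E') i ≡ suc y → 0 < i
      positive zero e = ⊥-elim (0≢suc e)
      positive (suc _) _ = z<s
      j>0 : 0 < j
      j>0 = positive j ej
      crossesFirstBlock : Crossing (0 ∷ (map suc C ++ 0 ∷ E'))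
      crossesFirstBlock = 0 , suc p , suc (lC + 0) , suc (lC + j) , z<s , s<s (≤-trans p<lC (m≤m+n lC 0)) ,
        s<s (+-monoʳ-< lC j>0) , subst (suc (lC + j) <_) (sym (cong suc (length-++ (map suc C)))) (s<s (+-monoʳ-< lC j<)) ,
        sym (at-++ʳ (map suc C) (0 ∷ E') 0) ,
        trans (at-++ˡ (map suc C) _ p p<lC) (trans (at-map suc C p p<C) (trans (cong suc (proj₂ (proj₂ sj))) (sym (trans (at-++ʳ (map suc C) _ j) ej)))) ,
        (λ e → 0≢suc (trans e (trans (at-++ˡ (map suc C) _ p p<lC) (at-map suc C p p<C))))

  rgs-unshift : ∀ k E → ZeroHeaded E → T (rgsFrom (suc k) E) → (∀ j → j < length E → at E j ≡ 0 ⊎ k < at E j) →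
    T (rgsFrom 0 (map (unshift k) E))
  rgs-unshift k .[] (inj₁ refl) _ _ = tt
  rgs-unshift k .(0 ∷ E') (inj₂ (E' , refl)) hE fresh =
    subst T (rgs-shift 1 k (map (unshift k) E') (s≤s z≤n))
      (subst (λ t → T (rgsFrom (suc k) t)) (sym (map-shift-unshift k E' (λ j j< → fresh (suc j) (s<s j<))))
        (subst (λ t → T (rgsFrom t E')) (cong suc (⊔-identityʳ k)) hE))

  glue-surjective : ∀ xs → T (rgsFrom 0 xs) → ¬ Crossing xs → xs ≢ [] →
    Σ Code λ C → Σ Code λ D → xs ≡ glue C D × T (rgsFrom 0 C) × T (rgsFrom 0 D)
  glue-surjective [] _ _ ne = ⊥-elim (ne refl)
  glue-surjective (suc x ∷ xs) () _ _
  glue-surjective (zero ∷ xs) h nc _ =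
    C , map (unshift k) E , cong (0 ∷_) (trans (sym eq) (cong (map suc C ++_) (sym (map-shift-unshift k E fresh)))) ,
    hC , rgs-unshift k E (splitAtZero-ZeroHeaded xs) hE fresh
    where
      C = proj₁ (splitAtZero xs)
      E = proj₂ (splitAtZero xs)
      k = nblocks C
      eq : map suc C ++ E ≡ xs
      eq = splitAtZero-++ xs
      h' : T (rgsFrom 1 (map suc C ++ E))
      h' = subst (λ t → T (rgsFrom 1 t)) (sym eq) h
      hC : T (rgsFrom 0 C)
      hC = subst T (rgs-suc 0 C) (rgs-++₁ 1 (map suc C) E h')
      hE : T (rgsFrom (suc k) E)
      hE = subst (λ t → T (rgsFrom t E)) (trans (labelsAfter-suc 0 C) (cong suc (labelsAfter-0 C))) (rgs-++₂ 1 (map suc C) E h')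
      fresh : ∀ j → j < length E → at E j ≡ 0 ⊎ k < at E j
      fresh = tailLabels-fresh C E hC (λ cr → nc (subst (λ t → Crossing (0 ∷ t)) eq cr)) (splitAtZero-ZeroHeaded xs)

module Enumeration where

  open BooleanReflection
  open Glueing
  open import Data.Nat using (ℕ; zero; suc; _+_; _∸_; _≤_; s≤s; _⊔_)
  open import Data.Nat.Properties
  open import Data.Bool using (not; T)
  open import Data.Bool.Properties using (T?)
  open import Data.List using (List; []; _∷_; [_]; map; length; upTo; concatMap)
  open import Data.List.Properties using (∷-injectiveˡ; ∷-injectiveʳ; ++-cancelˡ)
  open import Data.List.Membership.Propositional using (_∈_)
  open import Data.List.Membership.Propositional.Properties using (∈-map⁺; ∈-map⁻; ∈-++⁺ˡ; ∈-++⁺ʳ; ∈-++⁻; ∈-upTo⁺; ∈-upTo⁻; ∈-filter⁺; ∈-filter⁻)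
  open import Data.List.Relation.Unary.Any using (Any; here; there)
  open import Data.List.Relation.Unary.AllPairs using ([]; _∷_)
  import Data.List.Relation.Unary.All as All
  open import Data.List.Relation.Unary.Unique.Propositional using (Unique)
  import Data.List.Relation.Unary.Unique.Propositional.Properties as UP
  open import Data.Product using (Σ; _×_; _,_; proj₁; proj₂)
  open import Data.Sum using (inj₁; inj₂; [_,_]′)
  open import Data.Unit using (tt)
  open import Relation.Nullary using (¬_)
  open import Relation.Binary.PropositionalEquality using (_≡_; refl; sym; trans; cong; cong₂; subst; _≢_)
  open import Function using (_∘_)

  ∈-concatMap-witness : ∀ {A B : Set} (g : A → List B) (xs : List A) {z} → z ∈ concatMap g xs → Σ A λ x → x ∈ xs × z ∈ g x
  ∈-concatMap-witness g (x ∷ xs) {z} h with ∈-++⁻ (g x) h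
  ... | inj₁ p = x , here refl , p
  ... | inj₂ p = let (y , y∈ , q) = ∈-concatMap-witness g xs p in y , there y∈ , q

  ∈-concatMap-intro : ∀ {A B : Set} (g : A → List B) {xs : List A} {x z} → x ∈ xs → z ∈ g x → z ∈ concatMap g xs
  ∈-concatMap-intro g {x ∷ xs} (here refl) p = ∈-++⁺ˡ p
  ∈-concatMap-intro g {x ∷ xs} (there m) p = ∈-++⁺ʳ (g x) (∈-concatMap-intro g m p)

  Unique-concatMap : ∀ {A B : Set} (g : A → List B) (xs : List A) → Unique xs → (∀ x → Unique (g x)) →
    (∀ x y z → z ∈ g x → z ∈ g y → x ≡ y) → Unique (concatMap g xs)
  Unique-concatMap g [] _ _ _ = []
  Unique-concatMap g (x ∷ xs) u ug dis = UP.++⁺ (ug x) (Unique-concatMap g xs (tl u) ug dis) d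
    where
      tl : ∀ {y ys} → Unique (y ∷ ys) → Unique ys
      tl (_ ∷ r) = r
      d : ∀ {v} → ¬ (Any (v ≡_) (g x) × Any (v ≡_) (concatMap g xs))
      d (p , q) = let (y , y∈ , r) = ∈-concatMap-witness g xs q in UP.Unique[x∷xs]⇒x∉xs u (subst (_∈ xs) (sym (dis x y _ p r)) y∈)

  genRGS⁻ : ∀ k m xs → xs ∈ genRGS k m → length xs ≡ k × T (rgsFrom m xs)
  genRGS⁻ zero m .[] (here refl) = refl , tt
  genRGS⁻ (suc k) m xs h =
    let (a , a∈ , p) = ∈-concatMap-witness (λ a → map (a ∷_) (genRGS k (m ⊔ suc a))) (upTo (suc m)) h
        (ys , ys∈ , e) = ∈-map⁻ _ p
        (l , r) = genRGS⁻ k (m ⊔ suc a) ys ys∈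
    in subst (λ t → length t ≡ suc k × T (rgsFrom m t)) (sym e) (cong suc l , T-∧⁺ (≤⇒≤ᵇ (≤-pred (∈-upTo⁻ a∈))) r)

  genRGS⁺ : ∀ k m xs → length xs ≡ k → T (rgsFrom m xs) → xs ∈ genRGS k m
  genRGS⁺ zero m [] _ _ = here refl
  genRGS⁺ (suc k) m (a ∷ xs) l h =
    ∈-concatMap-intro (λ a → map (a ∷_) (genRGS k (m ⊔ suc a))) (∈-upTo⁺ (s≤s (rgs-head m a xs h)))
      (∈-map⁺ _ (genRGS⁺ k (m ⊔ suc a) xs (suc-injective l) (rgs-tail m a xs h)))

  genRGS-uniq : ∀ k m → Unique (genRGS k m)
  genRGS-uniq zero m = All.[] ∷ []
  genRGS-uniq (suc k) m = Unique-concatMap _ (upTo (suc m)) (UP.upTo⁺ (suc m))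
    (λ a → UP.map⁺ ∷-injectiveʳ (genRGS-uniq k (m ⊔ suc a)))
    (λ a b z p q → let (_ , _ , e1) = ∈-map⁻ _ p
                       (_ , _ , e2) = ∈-map⁻ _ q
                   in ∷-injectiveˡ (trans (sym e1) e2))

  ∈-allNCP⁻ : ∀ n q → q ∈ allNCP n → length q ≡ n × T (rgsFrom 0 q) × ¬ Crossing q
  ∈-allNCP⁻ n q h =
    let (p1 , p2) = ∈-filter⁻ (T? ∘ (λ s → not (crossing s))) {xs = genRGS n 0} h
        (l , r) = genRGS⁻ n 0 q p1
    in l , r , (λ c → T-not⁻ p2 (Crossing⇒crossing q c))

  ∈-allNCP⁺ : ∀ n q → length q ≡ n → T (rgsFrom 0 q) → ¬ Crossing q → q ∈ allNCP n
  ∈-allNCP⁺ n q l r nc = ∈-filter⁺ (T? ∘ (λ s → not (crossing s))) (genRGS⁺ n 0 q l r) (T-not⁺ (λ t → nc (crossing⇒Crossing q t)))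

  allNCP-unique : ∀ n → Unique (allNCP n)
  allNCP-unique n = UP.filter⁺ (T? ∘ (λ s → not (crossing s))) (genRGS-uniq n 0)

  gluedSized : ℕ → ℕ → List Code
  gluedSized n a = concatMap (λ C → map (glue C) (allNCP (n ∸ a))) (allNCP a)

  glued : ℕ → List Code
  glued n = concatMap (gluedSized n) (upTo (suc n))

  glue-injectiveʳ : ∀ C {D D'} → glue C D ≡ glue C D' → D ≡ D'
  glue-injectiveʳ C {D} {D'} e = map-inj (shift (nblocks C)) (shift-injective _) D D' (++-cancelˡ (map suc C) _ _ (∷-injectiveʳ e))

  glued-unique : ∀ n → Unique (glued n)
  glued-unique n = Unique-concatMap (gluedSized n) (upTo (suc n)) (UP.upTo⁺ (suc n)) gluedSized-unique gluedSized-disjoint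
    where
      ∈-gluedSized⁻ : ∀ a z → z ∈ gluedSized n a → Σ Code λ C → Σ Code λ D → C ∈ allNCP a × D ∈ allNCP (n ∸ a) × z ≡ glue C D
      ∈-gluedSized⁻ a z h =
        let (C , C∈ , p) = ∈-concatMap-witness _ (allNCP a) h
            (D , D∈ , e) = ∈-map⁻ _ p
        in C , D , C∈ , D∈ , e
      gluedSized-unique : ∀ a → Unique (gluedSized n a)
      gluedSized-unique a = Unique-concatMap _ (allNCP a) (allNCP-unique a) (λ C → UP.map⁺ (glue-injectiveʳ C) (allNCP-unique (n ∸ a)))
        (λ C C' z p q →
           let (D , D∈ , e1) = ∈-map⁻ _ p
               (D' , D'∈ , e2) = ∈-map⁻ _ q
           in proj₁ (glue-injective C D C' D' (ZeroHeaded-rgs D (proj₁ (proj₂ (∈-allNCP⁻ (n ∸ a) D D∈)))) (ZeroHeaded-rgs D' (proj₁ (proj₂ (∈-allNCP⁻ (n ∸ a) D' D'∈)))) (trans (sym e1) e2)))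
      gluedSized-disjoint : ∀ a b z → z ∈ gluedSized n a → z ∈ gluedSized n b → a ≡ b
      gluedSized-disjoint a b z p q =
        let (C , D , C∈ , D∈ , e1) = ∈-gluedSized⁻ a z p
            (C' , D' , C'∈ , D'∈ , e2) = ∈-gluedSized⁻ b z q
            eC = proj₁ (glue-injective C D C' D' (ZeroHeaded-rgs D (proj₁ (proj₂ (∈-allNCP⁻ (n ∸ a) D D∈)))) (ZeroHeaded-rgs D' (proj₁ (proj₂ (∈-allNCP⁻ (n ∸ b) D' D'∈)))) (trans (sym e1) e2))
        in trans (sym (proj₁ (∈-allNCP⁻ a C C∈))) (trans (cong length eC) (proj₁ (∈-allNCP⁻ b C' C'∈)))

  glued⊆allNCP : ∀ n z → z ∈ glued n → z ∈ allNCP (suc n)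
  glued⊆allNCP n z h =
    let (a , a∈ , p) = ∈-concatMap-witness (gluedSized n) (upTo (suc n)) h
        (C , C∈ , p2) = ∈-concatMap-witness _ (allNCP a) p
        (D , D∈ , e) = ∈-map⁻ _ p2
        (lC , rC , nC) = ∈-allNCP⁻ a C C∈
        (lD , rD , nD) = ∈-allNCP⁻ (n ∸ a) D D∈
        len : length (glue C D) ≡ suc n
        len = trans (length-glue C D) (cong suc (trans (cong₂ _+_ lC lD) (m+[n∸m]≡n (≤-pred (∈-upTo⁻ a∈)))))
        ncB : ¬ Crossing (glue C D)
        ncB cr = [ nC , nD ]′ (GlueLayout.Crossing-glue⁻ C D (ZeroHeaded-rgs D rD) cr)
    in subst (_∈ allNCP (suc n)) (sym e) (∈-allNCP⁺ (suc n) (glue C D) len (rgs-glue C D rC rD) ncB)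

  allNCP⊆glued : ∀ n z → z ∈ allNCP (suc n) → z ∈ glued n
  allNCP⊆glued n z h =
    let (l , r , nc) = ∈-allNCP⁻ (suc n) z h
        ne : z ≢ []
        ne e = 0≢s (trans (sym (cong length e)) l)
        (C , D , e , rC , rD) = glue-surjective z r nc ne
        l' : length C + length D ≡ n
        l' = suc-injective (trans (sym (length-glue C D)) (trans (cong length (sym e)) l))
        a = length C
        lD : length D ≡ n ∸ a
        lD = trans (sym (m+n∸m≡n a (length D))) (cong (_∸ a) l')
        a≤n : a ≤ n
        a≤n = subst (a ≤_) l' (m≤m+n a (length D))
        nC : ¬ Crossing C
        nC c = nc (subst Crossing (sym e) (GlueLayout.Crossing-glueˡ C D c))
        nD : ¬ Crossing D
        nD c = nc (subst Crossing (sym e) (GlueLayout.Crossing-glueʳ C D c))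
    in subst (_∈ glued n) (sym e)
         (∈-concatMap-intro (gluedSized n) (∈-upTo⁺ (s≤s a≤n))
           (∈-concatMap-intro (λ C → map (glue C) (allNCP (n ∸ a))) (∈-allNCP⁺ a C refl rC nC) (∈-map⁺ _ (∈-allNCP⁺ (n ∸ a) D lD rD nD))))
    where
      0≢s : ∀ {n} → 0 ≢ suc n
      0≢s ()

module Counting where

  open BooleanReflection
  open Glueing
  open import Data.Nat using (ℕ; zero; suc; _+_; _<_; s≤s; _≡ᵇ_; _⊔_; _≟_)
  open import Data.Nat.Properties
  open import Data.Bool using (Bool; true; false; _∨_; not; if_then_else_; T)
  open import Data.Bool.Properties using (T?)
  open import Data.List using (List; []; _∷_; [_]; map; length; upTo; applyUpTo; _++_; filterᵇ; deduplicate)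
  open import Data.List.Properties using (map-∘; map-upTo; map-cong-local; filter-all; upTo-∷ʳ; length-upTo; map-id-local)
  open import Data.List.Membership.Propositional using (_∈_)
  open import Data.List.Membership.Propositional.Properties using (∈-upTo⁻; ∈-filter⁻)
  open import Data.List.Relation.Unary.All using (All; []; _∷_)
  import Data.List.Relation.Unary.All as All
  open import Data.List.Relation.Unary.AllPairs using ([]; _∷_)
  open import Data.List.Relation.Unary.Unique.Propositional using (Unique)
  import Data.List.Relation.Unary.Unique.Propositional.Properties as UP
  open import Data.Product using (proj₁)
  open import Data.Empty using (⊥-elim)
  open import Data.Unit using (tt)
  open import Relation.Nullary using (¬?)
  open import Relation.Binary.PropositionalEquality using (_≡_; refl; sym; trans; cong; cong₂; subst; _≢_)
  import Relation.Binary.PropositionalEquality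
  open import Function using (_∘_; id)

  ≡ᵇ-refl : ∀ x → (x ≡ᵇ x) ≡ true
  ≡ᵇ-refl zero = refl
  ≡ᵇ-refl (suc x) = ≡ᵇ-refl x

  ≡ᵇ-false : ∀ {x y} → x ≢ y → (x ≡ᵇ y) ≡ false
  ≡ᵇ-false {x} {y} ne with x ≡ᵇ y in e
  ... | true = ⊥-elim (ne (≡ᵇ⇒ (subst T (sym e) tt)))
  ... | false = refl

  ≡ᵇ-ext : ∀ {m n m' n'} → (m ≡ n → m' ≡ n') → (m' ≡ n' → m ≡ n) → (m ≡ᵇ n) ≡ (m' ≡ᵇ n')
  ≡ᵇ-ext {m} {n} {m'} {n'} f g with m ≡ᵇ n in e1 | m' ≡ᵇ n' in e2
  ... | true | true = refl
  ... | false | false = refl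
  ... | true | false = ⊥-elim (subst T e2 (⇒≡ᵇ (f (≡ᵇ⇒ (subst T (sym e1) tt)))))
  ... | false | true = ⊥-elim (subst T e1 (⇒≡ᵇ (g (≡ᵇ⇒ (subst T (sym e2) tt)))))

  count : ℕ → List ℕ → ℕ
  count b [] = 0
  count b (x ∷ xs) = if x ≡ᵇ b then suc (count b xs) else count b xs

  count-++ : ∀ b (xs ys : List ℕ) → count b (xs ++ ys) ≡ count b xs + count b ys
  count-++ b [] ys = refl
  count-++ b (x ∷ xs) ys with x ≡ᵇ b
  ... | true = cong suc (count-++ b xs ys)
  ... | false = count-++ b xs ys

  count-map : ∀ (f : ℕ → ℕ) b b' → (∀ x → (f x ≡ᵇ b) ≡ (x ≡ᵇ b')) → ∀ xs → count b (map f xs) ≡ count b' xs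
  count-map f b b' h [] = refl
  count-map f b b' h (x ∷ xs) rewrite h x with x ≡ᵇ b'
  ... | true = cong suc (count-map f b b' h xs)
  ... | false = count-map f b b' h xs

  count-none : ∀ (f : ℕ → ℕ) b → (∀ x → (f x ≡ᵇ b) ≡ false) → ∀ xs → count b (map f xs) ≡ 0
  count-none f b h [] = refl
  count-none f b h (x ∷ xs) rewrite h x = count-none f b h xs

  count-beyondMax : ∀ b (xs : List ℕ) → maxL xs < b → count b xs ≡ 0
  count-beyondMax b [] _ = refl
  count-beyondMax b (x ∷ xs) h rewrite ≡ᵇ-false {x} {b} (<⇒≢ (≤-<-trans (m≤m⊔n x (maxL xs)) h)) =
    count-beyondMax b xs (≤-<-trans (m≤n⊔m x (maxL xs)) h)

  countIndices : (ℕ → Bool) → ℕ → ℕ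
  countIndices p zero = 0
  countIndices p (suc n) = if p 0 then suc (countIndices (p ∘ suc) n) else countIndices (p ∘ suc) n

  length-filter-applyUpTo : ∀ (p : ℕ → Bool) (f : ℕ → ℕ) n → length (filterᵇ p (applyUpTo f n)) ≡ countIndices (p ∘ f) n
  length-filter-applyUpTo p f zero = refl
  length-filter-applyUpTo p f (suc n) with p (f 0)
  ... | true = cong suc (length-filter-applyUpTo p (f ∘ suc) n)
  ... | false = length-filter-applyUpTo p (f ∘ suc) n

  countIndices-at : ∀ b (xs : List ℕ) → countIndices (λ i → at xs i ≡ᵇ b) (length xs) ≡ count b xs
  countIndices-at b [] = refl
  countIndices-at b (x ∷ xs) with x ≡ᵇ b
  ... | true = cong suc (countIndices-at b xs)
  ... | false = countIndices-at b xs

  length-blockOf : ∀ q b → length (blockOf q b) ≡ count b q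
  length-blockOf q b = trans (length-filter-applyUpTo (λ i → at q i ≡ᵇ b) id (length q)) (countIndices-at b q)

  blockOf-uniq : ∀ q b → Unique (blockOf q b)
  blockOf-uniq q b = UP.filter⁺ (T? ∘ (λ i → at q i ≡ᵇ b)) (UP.upTo⁺ (length q))

  blockOf-bound : ∀ q b i → i ∈ blockOf q b → i < length q
  blockOf-bound q b i h = ∈-upTo⁻ (proj₁ (∈-filter⁻ (T? ∘ (λ i → at q i ≡ᵇ b)) {xs = upTo (length q)} h))

  count0-glue : ∀ C D → count 0 (glue C D) ≡ suc (count 0 D)
  count0-glue C D = cong suc (trans (count-++ 0 (map suc C) _)
    (cong₂ _+_ (count-none suc 0 (λ x → refl) C) (count-map (shift (nblocks C)) 0 0 h D)))
    where
      h : ∀ x → (shift (nblocks C) x ≡ᵇ 0) ≡ (x ≡ᵇ 0)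
      h zero = refl
      h (suc x) = refl

  count-glueˡ : ∀ C D b → b < nblocks C → count (suc b) (glue C D) ≡ count b C
  count-glueˡ C D b b< = trans (count-++ (suc b) (map suc C) _)
    (trans (cong₂ _+_ (count-map suc (suc b) b (λ x → refl) C) (count-none (shift (nblocks C)) (suc b) h D)) (+-identityʳ _))
    where
      h : ∀ x → (shift (nblocks C) x ≡ᵇ suc b) ≡ false
      h zero = refl
      h (suc x) = ≡ᵇ-false (λ e → <-irrefl refl (≤-trans (s≤s b<) (s≤s (≤-trans (m≤n+m (nblocks C) x) (≤-reflexive (suc-injective e))))))

  count-glueʳ : ∀ C D b → count (suc (nblocks C + b)) (glue C D) ≡ count (suc b) D
  count-glueʳ C D b = trans (count-++ (suc (nblocks C + b)) (map suc C) _)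
    (cong₂ _+_ (count-left-beyond C)
      (count-map (shift (nblocks C)) _ (suc b) h D))
    where
      k = nblocks C
      count-left-beyond : ∀ C → count (suc (nblocks C + b)) (map suc C) ≡ 0
      count-left-beyond [] = refl
      count-left-beyond (x ∷ xs) = trans (count-map suc _ (nblocks (x ∷ xs) + b) (λ y → refl) (x ∷ xs)) (count-beyondMax _ (x ∷ xs) (m≤m+n _ b))
      h : ∀ x → (shift k x ≡ᵇ suc (k + b)) ≡ (x ≡ᵇ suc b)
      h zero = refl
      h (suc x) = ≡ᵇ-ext (λ e → cong suc (+-cancelʳ-≡ k x b (trans (suc-injective e) (+-comm k b))))
                         (λ e → trans (cong (λ t → suc t + k) (suc-injective e)) (cong suc (+-comm b k)))

  maxL-++ : ∀ (xs ys : List ℕ) → maxL (xs ++ ys) ≡ maxL xs ⊔ maxL ys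
  maxL-++ [] ys = refl
  maxL-++ (x ∷ xs) ys = trans (cong (x ⊔_) (maxL-++ xs ys)) (sym (⊔-assoc x (maxL xs) (maxL ys)))

  maxL-suc : ∀ (xs : List ℕ) → maxL (map suc xs) ≡ nblocks xs
  maxL-suc [] = refl
  maxL-suc (x ∷ []) = trans (⊔-identityʳ (suc x)) (cong suc (sym (⊔-identityʳ x)))
  maxL-suc (x ∷ y ∷ xs) = cong (suc x ⊔_) (maxL-suc (y ∷ xs))

  maxL-shift : ∀ k (D : List ℕ) → k ⊔ maxL (map (shift k) D) ≡ k + maxL D
  maxL-shift k [] = trans (⊔-identityʳ k) (sym (+-identityʳ k))
  maxL-shift k (y ∷ D) = begin
      k ⊔ (shift k y ⊔ maxL (map (shift k) D))
    ≡⟨ cong (_⊔ (shift k y ⊔ maxL (map (shift k) D))) (sym (⊔-idem k)) ⟩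
      (k ⊔ k) ⊔ (shift k y ⊔ maxL (map (shift k) D))
    ≡⟨ ⊔-assoc k k _ ⟩
      k ⊔ (k ⊔ (shift k y ⊔ maxL (map (shift k) D)))
    ≡⟨ cong (k ⊔_) (sym (⊔-assoc k (shift k y) _)) ⟩
      k ⊔ ((k ⊔ shift k y) ⊔ maxL (map (shift k) D))
    ≡⟨ cong (λ t → k ⊔ (t ⊔ maxL (map (shift k) D))) (⊔-comm k (shift k y)) ⟩
      k ⊔ ((shift k y ⊔ k) ⊔ maxL (map (shift k) D))
    ≡⟨ cong (k ⊔_) (⊔-assoc (shift k y) k _) ⟩
      k ⊔ (shift k y ⊔ (k ⊔ maxL (map (shift k) D)))
    ≡⟨ sym (⊔-assoc k (shift k y) _) ⟩
      (k ⊔ shift k y) ⊔ (k ⊔ maxL (map (shift k) D))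
    ≡⟨ cong₂ _⊔_ (hd y) (maxL-shift k D) ⟩
      (k + y) ⊔ (k + maxL D)
    ≡⟨ sym (+-distribˡ-⊔ k y (maxL D)) ⟩
      k + (y ⊔ maxL D) ∎
    where
      open Relation.Binary.PropositionalEquality.≡-Reasoning
      hd : ∀ y → k ⊔ shift k y ≡ k + y
      hd zero = trans (⊔-identityʳ k) (sym (+-identityʳ k))
      hd (suc y) = trans (m≤n⇒m⊔n≡n (m≤n+m k (suc y))) (+-comm (suc y) k)

  maxL-glue : ∀ C D → maxL (glue C D) ≡ nblocks C + maxL D
  maxL-glue C D = trans (maxL-++ (map suc C) _) (trans (cong (_⊔ maxL (map (shift (nblocks C)) D)) (maxL-suc C)) (maxL-shift (nblocks C) D))

  applyUpTo-+ : ∀ (f : ℕ → ℕ) a b → applyUpTo f (a + b) ≡ applyUpTo f a ++ applyUpTo (λ x → f (a + x)) b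
  applyUpTo-+ f zero b = refl
  applyUpTo-+ f (suc a) b = cong (f 0 ∷_) (applyUpTo-+ (f ∘ suc) a b)

  at-app : ∀ (f : ℕ → ℕ) n i → i < n → at (applyUpTo f n) i ≡ f i
  at-app f (suc n) zero _ = refl
  at-app f (suc n) (suc i) (s≤s p) = at-app (f ∘ suc) n i p

  maxL-upTo : ∀ m → maxL (upTo (suc m)) ≡ m
  maxL-upTo m = trans (cong maxL (sym (upTo-∷ʳ m))) (trans (maxL-++ (upTo m) [ m ]) (trans (cong (maxL (upTo m) ⊔_) (⊔-identityʳ m)) (maxL-upTo-⊔ m)))
    where
      maxL-upTo-⊔ : ∀ m → maxL (upTo m) ⊔ m ≡ m
      maxL-upTo-⊔ zero = refl
      maxL-upTo-⊔ (suc m) = trans (cong (_⊔ suc m) (maxL-upTo m)) (m≤n⇒m⊔n≡n (n≤1+n m))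

  nblocks-upTo : ∀ m → nblocks (upTo (suc m)) ≡ suc m
  nblocks-upTo m = cong suc (maxL-upTo m)

  upTo-suc : ∀ n → upTo (suc n) ≡ 0 ∷ map suc (upTo n)
  upTo-suc n = cong (0 ∷_) (sym (map-upTo suc n))

  deduplicate-unique : ∀ (xs : List ℕ) → Unique xs → deduplicate _≟_ xs ≡ xs
  deduplicate-unique [] _ = refl
  deduplicate-unique (x ∷ xs) (h ∷ u) rewrite deduplicate-unique xs u = cong (x ∷_) (filter-all (¬? ∘ (x ≟_)) h)

  indexOf-head : ∀ x (ys : List ℕ) → indexOf x (x ∷ ys) ≡ 0
  indexOf-head x ys rewrite ≡ᵇ-refl x = refl

  indexOf-tail : ∀ y x (ys : List ℕ) → y ≢ x → indexOf y (x ∷ ys) ≡ suc (indexOf y ys)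
  indexOf-tail y x ys ne rewrite ≡ᵇ-false ne = refl

  indexOf-self : ∀ (xs : List ℕ) → Unique xs → map (λ y → indexOf y xs) xs ≡ upTo (length xs)
  indexOf-self [] _ = refl
  indexOf-self (x ∷ xs) (h ∷ u) = begin
      indexOf x (x ∷ xs) ∷ map (λ y → indexOf y (x ∷ xs)) xs
    ≡⟨ cong₂ _∷_ (indexOf-head x xs) (map-cong-local (All.map (λ {y} ne → indexOf-tail y x xs (λ e → ne (sym e))) h)) ⟩
      0 ∷ map (λ y → suc (indexOf y xs)) xs
    ≡⟨ cong (0 ∷_) (map-∘ xs) ⟩
      0 ∷ map suc (map (λ y → indexOf y xs) xs)
    ≡⟨ cong (λ t → 0 ∷ map suc t) (indexOf-self xs u) ⟩
      0 ∷ map suc (upTo (length xs))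
    ≡⟨ sym (upTo-suc (length xs)) ⟩
      upTo (suc (length xs)) ∎
    where open Relation.Binary.PropositionalEquality.≡-Reasoning

  std-unique : ∀ (xs : List ℕ) → Unique xs → std xs ≡ upTo (length xs)
  std-unique xs u = trans (cong (λ d → map (λ x → indexOf x d) xs) (deduplicate-unique xs u)) (indexOf-self xs u)

  restrict-J : ∀ m (τ : List ℕ) → (∀ {i} → i ∈ τ → i < m) → Unique τ → restrict (upTo m) τ ≡ upTo (length τ)
  restrict-J m τ bd u = trans (cong std (map-id-local (All.tabulate (λ {i} i∈ → at-app id m i (bd i∈))))) (std-unique τ u)

  coarser-J : ∀ m q → T (coarser (upTo m) q)
  coarser-J m q = all-upTo⁺ _ (length (upTo m)) (λ i i< → all-upTo⁺ _ (length (upTo m)) (λ j j< → sameLabel⇒sameBlock i j i< j<))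
    where
      sameLabel⇒sameBlock : ∀ i j → i < length (upTo m) → j < length (upTo m) → T (not (at (upTo m) i ≡ᵇ at (upTo m) j) ∨ (at q i ≡ᵇ at q j))
      sameLabel⇒sameBlock i j i< j< with at (upTo m) i ≡ᵇ at (upTo m) j in e
      ... | false = tt
      ... | true rewrite trans (sym (at-app id m i (subst (i <_) (length-upTo m) i<)))
                          (trans (≡ᵇ⇒ (subst T (sym e) tt)) (at-app id m j (subst (j <_) (length-upTo m) j<)))
                   | ≡ᵇ-refl (at q j) = tt

module Standardization where

  open BooleanReflection
  open Glueing
  open Counting
  open import Data.Nat using (ℕ; zero; suc; _≤_; _<_; s≤s; _≡ᵇ_; _⊔_; _≟_)
  open import Data.Nat.Properties
  open import Data.Bool using (true; false; _∧_; if_then_else_; T)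
  open import Data.List using (List; []; _∷_; map; length; deduplicate; filter)
  open import Data.List.Properties using (length-map; length-filter; filter-accept; filter-reject; filter-idem)
  open import Data.List.Membership.Propositional using (_∈_)
  open import Data.List.Membership.Propositional.Properties using (∈-filter⁺)
  open import Data.List.Relation.Unary.Any using (here; there)
  open import Data.List.Relation.Unary.All using ([]; _∷_)
  open import Data.Product using (_,_)
  open import Data.Unit using (tt)
  open import Relation.Nullary using (¬_; yes; no; ¬?)
  open import Relation.Binary.PropositionalEquality using (_≡_; refl; sym; trans; cong; cong₂; subst; _≢_)
  import Relation.Binary.PropositionalEquality
  open Relation.Binary.PropositionalEquality.≡-Reasoning
  open import Function using (_∘_)

  dedup : List ℕ → List ℕ
  dedup = deduplicate _≟_

  without : ℕ → List ℕ → List ℕ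
  without x = filter (¬? ∘ (x ≟_))

  without-hit : ∀ x z zs → x ≡ z → without x (z ∷ zs) ≡ without x zs
  without-hit x z zs e = filter-reject (¬? ∘ (x ≟_)) (λ ne → ne e)

  without-miss : ∀ x z zs → x ≢ z → without x (z ∷ zs) ≡ z ∷ without x zs
  without-miss x z zs ne = filter-accept (¬? ∘ (x ≟_)) ne

  without-comm : ∀ x y zs → without x (without y zs) ≡ without y (without x zs)
  without-comm x y [] = refl
  without-comm x y (z ∷ zs) with y ≟ z | x ≟ z
  ... | yes p | yes q = begin
      without x (without y (z ∷ zs)) ≡⟨ cong (without x) (without-hit y z zs p) ⟩
      without x (without y zs) ≡⟨ without-comm x y zs ⟩
      without y (without x zs) ≡⟨ cong (without y) (sym (without-hit x z zs q)) ⟩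
      without y (without x (z ∷ zs)) ∎
  ... | yes p | no q = begin
      without x (without y (z ∷ zs)) ≡⟨ cong (without x) (without-hit y z zs p) ⟩
      without x (without y zs) ≡⟨ without-comm x y zs ⟩
      without y (without x zs) ≡⟨ sym (without-hit y z _ p) ⟩
      without y (z ∷ without x zs) ≡⟨ cong (without y) (sym (without-miss x z zs q)) ⟩
      without y (without x (z ∷ zs)) ∎
  ... | no p | yes q = begin
      without x (without y (z ∷ zs)) ≡⟨ cong (without x) (without-miss y z zs p) ⟩
      without x (z ∷ without y zs) ≡⟨ without-hit x z _ q ⟩
      without x (without y zs) ≡⟨ without-comm x y zs ⟩
      without y (without x zs) ≡⟨ cong (without y) (sym (without-hit x z zs q)) ⟩
      without y (without x (z ∷ zs)) ∎
  ... | no p | no q = begin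
      without x (without y (z ∷ zs)) ≡⟨ cong (without x) (without-miss y z zs p) ⟩
      without x (z ∷ without y zs) ≡⟨ without-miss x z _ q ⟩
      z ∷ without x (without y zs) ≡⟨ cong (z ∷_) (without-comm x y zs) ⟩
      z ∷ without y (without x zs) ≡⟨ sym (without-miss y z _ p) ⟩
      without y (z ∷ without x zs) ≡⟨ cong (without y) (sym (without-miss x z zs q)) ⟩
      without y (without x (z ∷ zs)) ∎

  without-idem : ∀ x zs → without x (without x zs) ≡ without x zs
  without-idem x zs = filter-idem (¬? ∘ (x ≟_)) zs

  without-dedup : ∀ x xs → without x (dedup xs) ≡ dedup (without x xs)
  without-dedup x [] = refl
  without-dedup x (y ∷ ys) with x ≟ y
  ... | yes p = begin
      without x (y ∷ without y (dedup ys)) ≡⟨ without-hit x y _ p ⟩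
      without x (without y (dedup ys)) ≡⟨ cong (λ t → without x (without t (dedup ys))) (sym p) ⟩
      without x (without x (dedup ys)) ≡⟨ without-idem x (dedup ys) ⟩
      without x (dedup ys) ≡⟨ without-dedup x ys ⟩
      dedup (without x ys) ≡⟨ cong dedup (sym (without-hit x y ys p)) ⟩
      dedup (without x (y ∷ ys)) ∎
  ... | no np = begin
      without x (y ∷ without y (dedup ys)) ≡⟨ without-miss x y _ np ⟩
      y ∷ without x (without y (dedup ys)) ≡⟨ cong (y ∷_) (without-comm x y (dedup ys)) ⟩
      y ∷ without y (without x (dedup ys)) ≡⟨ cong (λ t → y ∷ without y t) (without-dedup x ys) ⟩
      y ∷ without y (dedup (without x ys)) ≡⟨⟩
      dedup (y ∷ without x ys) ≡⟨ cong dedup (sym (without-miss x y ys np)) ⟩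
      dedup (without x (y ∷ ys)) ∎

  std-cons : ∀ x xs → std (x ∷ xs) ≡ 0 ∷ map (λ y → if y ≡ᵇ x then 0 else suc (indexOf y (dedup (without x xs)))) xs
  std-cons x xs = cong₂ _∷_ (indexOf-head x (without x (dedup xs))) (cong (λ F → map (λ y → if y ≡ᵇ x then 0 else suc (indexOf y F)) xs) (without-dedup x xs))

  rgs-inter : ∀ m x (h : ℕ → ℕ) xs → rgsFrom (suc m) (map (λ y → if y ≡ᵇ x then 0 else suc (h y)) xs) ≡ rgsFrom m (map h (without x xs))
  rgs-inter m x h [] = refl
  rgs-inter m x h (y ∷ ys) with x ≟ y
  ... | yes refl rewrite without-hit x x ys refl | ≡ᵇ-refl x = trans (cong (λ t → rgsFrom t (map (λ y → if y ≡ᵇ x then 0 else suc (h y)) ys)) (cong suc (⊔-identityʳ m))) (rgs-inter m x h ys)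
  ... | no np rewrite without-miss x y ys np | ≡ᵇ-false {y} {x} (λ e → np (sym e)) = cong₂ _∧_ (≤ᵇ-suc (h y) m) (rgs-inter (m ⊔ suc (h y)) x h ys)

  rgs-std : ∀ n ys → length ys ≤ n → T (rgsFrom 0 (std ys))
  rgs-std n [] _ = tt
  rgs-std (suc n) (x ∷ xs) (s≤s l) =
    subst (λ t → T (rgsFrom 0 t)) (sym (std-cons x xs))
      (subst T (sym (rgs-inter 0 x (λ y → indexOf y (dedup (without x xs))) xs))
        (rgs-std n (without x xs) (≤-trans (length-filter (¬? ∘ (x ≟_)) xs) l)))

  at-∈ : ∀ (ys : List ℕ) i → i < length ys → at ys i ∈ ys
  at-∈ (y ∷ ys) zero _ = here refl
  at-∈ (y ∷ ys) (suc i) (s≤s p) = there (at-∈ ys i p)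

  ∈-dedup : ∀ {y} (ys : List ℕ) → y ∈ ys → y ∈ dedup ys
  ∈-dedup (z ∷ zs) (here refl) = here refl
  ∈-dedup {y} (z ∷ zs) (there p) with z ≟ y
  ... | yes refl = here refl
  ... | no np = there (∈-filter⁺ (¬? ∘ (z ≟_)) (∈-dedup zs p) np)

  at-indexOf : ∀ x (d : List ℕ) → x ∈ d → at d (indexOf x d) ≡ x
  at-indexOf x (z ∷ zs) (here refl) rewrite ≡ᵇ-refl x = refl
  at-indexOf x (z ∷ zs) (there p) with x ≡ᵇ z in e
  ... | true = sym (≡ᵇ⇒ (subst T (sym e) tt))
  ... | false = at-indexOf x zs p

  std-reflectsLabels : ∀ ys i j → i < length ys → j < length ys → at (std ys) i ≡ at (std ys) j → at ys i ≡ at ys j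
  std-reflectsLabels ys i j i< j< e =
    trans (sym (at-indexOf (at ys i) (dedup ys) (∈-dedup ys (at-∈ ys i i<))))
      (trans (cong (at (dedup ys)) (trans (sym (at-map _ ys i i<)) (trans e (at-map _ ys j j<))))
        (at-indexOf (at ys j) (dedup ys) (∈-dedup ys (at-∈ ys j j<))))

  length-std : ∀ ys → length (std ys) ≡ length ys
  length-std ys = length-map _ ys

  Increasing : List ℕ → Set
  Increasing X = ∀ i j → i < j → j < length X → at X i < at X j

  Below : ℕ → List ℕ → Set
  Below n X = ∀ i → i < length X → at X i < n

  Crossing-restrict : ∀ s X → Increasing X → Below (length s) X → Crossing (restrict s X) → Crossing s
  Crossing-restrict s X inc bnd (a , c , b , d , a<c , c<b , b<d , d<n , e1 , e2 , ne) =
    at X a , at X c , at X b , at X d , inc a c a<c cX , inc c b c<b bX , inc b d b<d dX , bnd d dX ,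
    sameLabel a b aX bX e1 , sameLabel c d cX dX e2 ,
    (λ e → ne (trans (at-map _ ys a (lY a aX)) (trans (cong (λ t → indexOf t (dedup ys)) (trans (at-map (at s) X a aX) (trans e (sym (at-map (at s) X c cX))))) (sym (at-map _ ys c (lY c cX))))))
    where
      ys = map (at s) X
      lY : ∀ i → i < length X → i < length ys
      lY i p = subst (i <_) (sym (length-map (at s) X)) p
      dX : d < length X
      dX = subst (d <_) (trans (length-std ys) (length-map (at s) X)) d<n
      bX = <-trans b<d dX
      cX = <-trans c<b bX
      aX = <-trans a<c cX
      sameLabel : ∀ i j → i < length X → j < length X → at (std ys) i ≡ at (std ys) j → at s (at X i) ≡ at s (at X j)
      sameLabel i j i< j< e = trans (sym (at-map (at s) X i i<)) (trans (std-reflectsLabels ys i j (lY i i<) (lY j j<) e) (at-map (at s) X j j<))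

  isNCP-restrict : ∀ s x X → Increasing (x ∷ X) → Below (length s) (x ∷ X) → ¬ Crossing s → T (isNCP (restrict s (x ∷ X)))
  isNCP-restrict s x X inc bnd nc =
    T-∧⁺ (rgs-std _ (map (at s) (x ∷ X)) ≤-refl) (T-not⁺ (λ t → nc (Crossing-restrict s (x ∷ X) inc bnd (crossing⇒Crossing _ t))))

  length-restrict : ∀ s X → length (restrict s X) ≡ length X
  length-restrict s X = trans (length-std (map (at s) X)) (length-map (at s) X)

module Cuts where

  open BooleanReflection
  open Glueing
  open Enumeration using (∈-concatMap-witness; ∈-concatMap-intro; Unique-concatMap)
  open import Data.Nat using (ℕ; zero; suc; _<_; z≤n; s≤s; z<s; s<s)
  open import Data.Nat.Properties
  open import Data.Bool using (Bool; true; false; T)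
  open import Data.Bool.Properties using (T?)
  open import Data.Bool.ListAction using (any)
  open import Data.List using (List; []; _∷_; length; upTo; applyUpTo; filterᵇ; replicate)
  open import Data.List.Properties using (∷-injectiveʳ; filter-accept; filter-none)
  open import Data.List.Membership.Propositional using (_∈_)
  open import Data.List.Membership.Propositional.Properties using (∈-upTo⁺; ∈-upTo⁻; ∈-filter⁺; ∈-filter⁻)
  open import Data.List.Relation.Unary.Any using (here; there)
  open import Data.List.Relation.Unary.All using (All; []; _∷_)
  import Data.List.Relation.Unary.All as All
  open import Data.List.Relation.Unary.AllPairs using ([]; _∷_)
  open import Data.List.Relation.Unary.Unique.Propositional using (Unique)
  open import Data.Product using (Σ; _×_; _,_)
  open import Data.Sum using (_⊎_; inj₁; inj₂)
  open import Data.Empty using (⊥-elim)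
  open import Data.Unit using (tt)
  open import Relation.Binary.PropositionalEquality using (_≡_; refl; sym; trans; cong; cong₂; subst; _≢_)
  open import Function using (_∘_)

  length-∈subsets : ∀ k bs → bs ∈ subsets k → length bs ≡ k
  length-∈subsets zero .[] (here refl) = refl
  length-∈subsets (suc k) bs h with ∈-concatMap-witness (λ bs → (false ∷ bs) ∷ (true ∷ bs) ∷ []) (subsets k) h
  ... | cs , cs∈ , here refl = cong suc (length-∈subsets k cs cs∈)
  ... | cs , cs∈ , there (here refl) = cong suc (length-∈subsets k cs cs∈)

  ∈-subsets : ∀ k bs → length bs ≡ k → bs ∈ subsets k
  ∈-subsets zero [] _ = here refl
  ∈-subsets (suc k) (false ∷ bs) l = ∈-concatMap-intro (λ bs → (false ∷ bs) ∷ (true ∷ bs) ∷ []) (∈-subsets k bs (suc-injective l)) (here refl)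
  ∈-subsets (suc k) (true ∷ bs) l = ∈-concatMap-intro (λ bs → (false ∷ bs) ∷ (true ∷ bs) ∷ []) (∈-subsets k bs (suc-injective l)) (there (here refl))

  subsets-unique : ∀ k → Unique (subsets k)
  subsets-unique zero = All.[] ∷ []
  subsets-unique (suc k) = Unique-concatMap _ (subsets k) (subsets-unique k)
    (λ bs → ((λ ()) All.∷ All.[]) ∷ (All.[] ∷ []))
    (λ x y z p q → sameSuffix x y z p q)
    where
      sameSuffix : ∀ x y z → z ∈ (false ∷ x) ∷ (true ∷ x) ∷ [] → z ∈ (false ∷ y) ∷ (true ∷ y) ∷ [] → x ≡ y
      sameSuffix x y z (here refl) (here e) = ∷-injectiveʳ e
      sameSuffix x y z (here refl) (there (here ()))
      sameSuffix x y z (there (here refl)) (here ())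
      sameSuffix x y z (there (here refl)) (there (here e)) = ∷-injectiveʳ e

  bit-allFalse : ∀ k i → bit (replicate k false) i ≡ false
  bit-allFalse zero i = refl
  bit-allFalse (suc k) zero = refl
  bit-allFalse (suc k) (suc i) = bit-allFalse k i

  allFalse⇒replicate : ∀ (bs : List Bool) → (∀ b → b < length bs → bit bs b ≡ false) → bs ≡ replicate (length bs) false
  allFalse⇒replicate [] _ = refl
  allFalse⇒replicate (b ∷ bs) h = cong₂ _∷_ (h 0 z<s) (allFalse⇒replicate bs (λ i i< → h (suc i) (s<s i<)))

  any⁻ : ∀ {A : Set} (p : A → Bool) (xs : List A) → T (any p xs) → Σ A λ x → x ∈ xs × T (p x)
  any⁻ p (x ∷ xs) h with T-∨⁻ {p x} h
  ... | inj₁ q = x , here refl , q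
  ... | inj₂ q = let (y , y∈ , r) = any⁻ p xs q in y , there y∈ , r

  lastL-∈ : ∀ x xs → lastL (x ∷ xs) ∈ (x ∷ xs)
  lastL-∈ x [] = here refl
  lastL-∈ x (y ∷ ys) = there (lastL-∈ y ys)

  lowerPositions : Code → List Bool → List ℕ
  lowerPositions s bs = filterᵇ (λ i → bit bs (at s i)) (upTo (length s))

  lowerPositions-emptyCut : ∀ s k → lowerPositions s (replicate k false) ≡ []
  lowerPositions-emptyCut s k = filter-none (T? ∘ (λ i → bit (replicate k false) (at s i))) {xs = upTo (length s)} (All.tabulate (λ {i} _ t → subst T (bit-allFalse k (at s i)) t))

  ∈-lowerPositions⁺ : ∀ s bs i → i < length s → T (bit bs (at s i)) → i ∈ lowerPositions s bs
  ∈-lowerPositions⁺ s bs i i< t = ∈-filter⁺ (T? ∘ (λ i → bit bs (at s i))) (∈-upTo⁺ i<) t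

  ∈-lowerPositions⁻ : ∀ s bs i → i ∈ lowerPositions s bs → i < length s × T (bit bs (at s i))
  ∈-lowerPositions⁻ s bs i h = let (p , q) = ∈-filter⁻ (T? ∘ (λ i → bit bs (at s i))) {xs = upTo (length s)} h in ∈-upTo⁻ p , q

  lowerPositions-head : ∀ xs bs → bit bs 0 ≡ true → lowerPositions (0 ∷ xs) bs ≡ 0 ∷ filterᵇ (λ i → bit bs (at (0 ∷ xs) i)) (applyUpTo suc (length xs))
  lowerPositions-head xs bs e = filter-accept (T? ∘ (λ i → bit bs (at (0 ∷ xs) i))) (subst T (sym e) tt)

  findTrue : ∀ (bs : List Bool) → (Σ ℕ λ b → b < length bs × bit bs b ≡ true) ⊎ (∀ b → b < length bs → bit bs b ≡ false)
  findTrue [] = inj₂ (λ b ())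
  findTrue (true ∷ bs) = inj₁ (0 , z<s , refl)
  findTrue (false ∷ bs) with findTrue bs
  ... | inj₁ (b , b< , e) = inj₁ (suc b , s<s b< , e)
  ... | inj₂ h = inj₂ (λ { zero _ → refl ; (suc b) (s≤s b<) → h b b< })

  label-occurs : ∀ s b → T (rgsFrom 0 s) → b < nblocks s → Σ ℕ λ i → i < length s × at s i ≡ b
  label-occurs s b r b< = rgs-labelOccurs 0 s b r z≤n (subst (b <_) (sym (labelsAfter-0 s)) b<)

  lowerPositions-nonempty : ∀ s bs → T (rgsFrom 0 s) → length bs ≡ nblocks s → bs ≢ replicate (nblocks s) false → Σ ℕ λ i → i ∈ lowerPositions s bs
  lowerPositions-nonempty s bs r l ne with findTrue bs
  ... | inj₂ h = ⊥-elim (ne (trans (allFalse⇒replicate bs h) (cong (λ t → replicate t false) l)))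
  ... | inj₁ (b , b< , e) =
    let (i , i< , ei) = label-occurs s b r (subst (b <_) l b<)
    in i , ∈-lowerPositions⁺ s bs i i< (subst T (sym (trans (cong (bit bs) ei) e)) tt)

module GapWords where

  open BooleanReflection
  open Counting
  open Standardization
  open Cuts
  open import Data.Nat using (ℕ; zero; suc; _+_; _≤_; _<_; z≤n; s≤s; _≡ᵇ_)
  open import Data.Nat.Properties
  open import Data.Bool using (Bool; true; false; not; if_then_else_; T)
  open import Data.Bool.Properties using (T?)
  open import Data.List using (List; []; _∷_; [_]; map; length; upTo; applyUpTo; _++_; filterᵇ; null; replicate)
  open import Data.List.Properties using (map-cong; length-filter; filter-reject)
  open import Data.List.Membership.Propositional using (_∈_)
  import Data.List.Membership.Propositional.Properties
  import Data.List.Properties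
  open import Data.List.Relation.Unary.Any using (here; there)
  open import Data.List.Relation.Unary.All using (All; []; _∷_)
  import Data.List.Relation.Unary.All as All
  open import Data.Product using (Σ; _×_; _,_)
  open import Relation.Nullary using (¬_)
  open import Relation.Binary.PropositionalEquality using (_≡_; refl; sym; trans; cong; cong₂; subst; _≢_)
  open import Function using (_∘_; id; _$_)

  range : ℕ → ℕ → List ℕ
  range k zero = []
  range k (suc n) = k ∷ range (suc k) n

  applyUpTo-range : ∀ (f : ℕ → ℕ) k n → (∀ i → f i ≡ k + i) → applyUpTo f n ≡ range k n
  applyUpTo-range f k zero h = refl
  applyUpTo-range f k (suc n) h = cong₂ _∷_ (trans (h 0) (+-identityʳ k)) (applyUpTo-range (f ∘ suc) (suc k) n (λ i → trans (h (suc i)) (+-suc k i)))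

  upTo-range : ∀ n → upTo n ≡ range 0 n
  upTo-range n = applyUpTo-range id 0 n (λ i → refl)

  at-range : ∀ a l i → i < l → at (range a l) i ≡ a + i
  at-range a (suc l) zero _ = sym (+-identityʳ a)
  at-range a (suc l) (suc i) (s≤s p) = trans (at-range (suc a) l i p) (sym (+-suc a i))

  length-range : ∀ a l → length (range a l) ≡ l
  length-range a zero = refl
  length-range a (suc l) = cong suc (length-range (suc a) l)

  Increasing-range : ∀ a l → Increasing (range a l)
  Increasing-range a l i j i<j j< = subst₂' (sym (at-range a l i (<-trans i<j j<'))) (sym (at-range a l j j<')) (+-monoʳ-< a i<j)
    where
      j<' = subst (j <_) (length-range a l) j<
      subst₂' : ∀ {x y x' y'} → x ≡ x' → y ≡ y' → x < y → x' < y'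
      subst₂' refl refl p = p

  Below-range : ∀ a l N → a + l ≤ N → Below N (range a l)
  Below-range a l N h i i< = subst (_< N) (sym (at-range a l i i<')) (<-≤-trans (+-monoʳ-< a i<') h)
    where i<' = subst (i <_) (length-range a l) i<

  Intervals : ℕ → List (List ℕ) → Set
  Intervals N gs = All (λ g → Σ ℕ λ a → Σ ℕ λ l → g ≡ range a l × a + l ≤ N) gs

  Intervals-resize : ∀ {N N'} gs → N ≡ N' → Intervals N gs → Intervals N' gs
  Intervals-resize gs refl h = h

  splitGaps-intervalsFrom : ∀ (p : ℕ → Bool) k n → Σ ℕ λ l₀ → Σ (List (List ℕ)) λ R →
    splitGaps (map (λ i → i , p i) (range k n)) ≡ range k l₀ ∷ R × l₀ ≤ n × Intervals (k + n) R
  splitGaps-intervalsFrom p k zero = 0 , [] , refl , z≤n , []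
  splitGaps-intervalsFrom p k (suc n) with splitGaps-intervalsFrom p (suc k) n | p k
  ... | l₁ , R₁ , eq , l₁≤ , g | true = 0 , range (suc k) l₁ ∷ R₁ , cong ([] ∷_) eq , z≤n ,
        ((suc k , l₁ , refl , ≤-trans (+-monoʳ-≤ (suc k) l₁≤) (≤-reflexive (sym (+-suc k n)))) ∷ Intervals-resize R₁ (sym (+-suc k n)) g)
  ... | l₁ , R₁ , eq , l₁≤ , g | false = suc l₁ , R₁ , cong (consHead k) eq , s≤s l₁≤ , Intervals-resize R₁ (sym (+-suc k n)) g

  splitGaps-intervals : ∀ (p : ℕ → Bool) n → Intervals n (splitGaps (map (λ i → i , p i) (upTo n)))
  splitGaps-intervals p n rewrite upTo-range n with splitGaps-intervalsFrom p 0 n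
  ... | l₀ , R , eq , l≤ , g rewrite eq = (0 , l₀ , refl , l≤) ∷ g

  totalLength : List (List ℕ) → ℕ
  totalLength [] = 0
  totalLength (g ∷ gs) = length g + totalLength gs

  totalLength-consHead : ∀ i gs → totalLength (consHead i gs) ≡ suc (totalLength gs)
  totalLength-consHead i [] = refl
  totalLength-consHead i (g ∷ gs) = refl

  totalLength-splitGaps : ∀ (p : ℕ → Bool) xs → totalLength (splitGaps (map (λ i → i , p i) xs)) ≡ length (filterᵇ (λ i → not (p i)) xs)
  totalLength-splitGaps p [] = refl
  totalLength-splitGaps p (x ∷ xs) with p x
  ... | true = totalLength-splitGaps p xs
  ... | false = trans (totalLength-consHead x (splitGaps (map (λ i → i , p i) xs))) (cong suc (totalLength-splitGaps p xs))

  totalLength-nonempty : ∀ gs → totalLength (filterᵇ (λ g → not (null g)) gs) ≡ totalLength gs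
  totalLength-nonempty [] = refl
  totalLength-nonempty ([] ∷ gs) = totalLength-nonempty gs
  totalLength-nonempty ((x ∷ g) ∷ gs) = cong (suc (length g) +_) (totalLength-nonempty gs)

  lowerWord : Code → List Bool → List Code
  lowerWord s bs = if null (lowerPositions s bs) then [] else [ restrict s (lowerPositions s bs) ]

  gapsOf : Code → List Bool → List (List ℕ)
  gapsOf s bs = filterᵇ (λ g → not (null g)) (splitGaps (map (λ i → i , bit bs (at s i)) (upTo (length s))))

  gapWord : Code → List Bool → List Code
  gapWord s bs = map (restrict s) (gapsOf s bs)

  size : List Code → ℕ
  size [] = 0
  size (x ∷ w) = length x + size w

  size-++ : ∀ w v → size (w ++ v) ≡ size w + size v
  size-++ [] v = refl
  size-++ (x ∷ w) v = trans (cong (length x +_) (size-++ w v)) (sym (+-assoc (length x) (size w) (size v)))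

  size-gapWord : ∀ s bs → size (gapWord s bs) ≡ totalLength (gapsOf s bs)
  size-gapWord s bs = size-map-restrict (gapsOf s bs)
    where
      size-map-restrict : ∀ gs → size (map (restrict s) gs) ≡ totalLength gs
      size-map-restrict [] = refl
      size-map-restrict (g ∷ gs) = cong₂ _+_ (length-restrict s g) (size-map-restrict gs)

  size-gapWord-unmarked : ∀ s bs → size (gapWord s bs) ≡ length (filterᵇ (λ i → not (bit bs (at s i))) (upTo (length s)))
  size-gapWord-unmarked s bs = trans (size-gapWord s bs) (trans (totalLength-nonempty (splitGaps (map (λ i → i , bit bs (at s i)) (upTo (length s))))) (totalLength-splitGaps (λ i → bit bs (at s i)) (upTo (length s))))

  length-unmarked≤ : ∀ (p : ℕ → Bool) n → p 0 ≡ true → length (filterᵇ (λ i → not (p i)) (upTo (suc n))) ≤ n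
  length-unmarked≤ p n e = subst (_≤ n) (cong length (sym (filter-reject (T? ∘ (λ i → not (p i))) {x = 0} {xs = applyUpTo suc n} (λ t → subst T (cong not e) t))))
    (≤-trans (length-filter (T? ∘ (λ i → not (p i))) (applyUpTo suc n)) (≤-reflexive (Data.List.Properties.length-applyUpTo suc n)))

  size-gapWord< : ∀ x xs bs → bit bs (at (x ∷ xs) 0) ≡ true → size (gapWord (x ∷ xs) bs) < suc (length xs)
  size-gapWord< x xs bs e = s≤s (subst (_≤ length xs) (sym (size-gapWord-unmarked (x ∷ xs) bs)) (length-unmarked≤ (λ i → bit bs (at (x ∷ xs) i)) (length xs) e))

  ∈-filterᵇ⁻ : ∀ {A : Set} (q : A → Bool) (xs : List A) {y} → y ∈ filterᵇ q xs → y ∈ xs × T (q y)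
  ∈-filterᵇ⁻ q xs h = Data.List.Membership.Propositional.Properties.∈-filter⁻ (T? ∘ q) {xs = xs} h

  gapWord-NCP : ∀ s bs → ¬ Crossing s → All (λ P → T (isNCP P)) (gapWord s bs)
  gapWord-NCP s bs nc = All.tabulate λ {P} P∈ →
    let (g , g∈ , e) = Data.List.Membership.Propositional.Properties.∈-map⁻ (restrict s) P∈
        (g∈' , nn) = ∈-filterᵇ⁻ (λ g → not (null g)) _ g∈
        (a , l , eg , bd) = All.lookup (splitGaps-intervals (λ i → bit bs (at s i)) (length s)) g∈'
    in subst (T ∘ isNCP) (sym e) (interval-NCP g a l eg bd nn)
    where
      interval-NCP : ∀ g a l → g ≡ range a l → a + l ≤ length s → T (not (null g)) → T (isNCP (restrict s g))
      interval-NCP .(range a (suc l)) a (suc l) refl bd _ = isNCP-restrict s a (range (suc a) l) (Increasing-range a (suc l)) (Below-range a (suc l) (length s) bd) nc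

  lowerWord-emptyCut : ∀ s k → lowerWord s (replicate k false) ≡ []
  lowerWord-emptyCut s k rewrite lowerPositions-emptyCut s k = refl

  lowerWord-nonempty : ∀ s bs x xs → lowerPositions s bs ≡ x ∷ xs → lowerWord s bs ≡ [ restrict s (x ∷ xs) ]
  lowerWord-nonempty s bs x xs e rewrite e = refl

  splitGaps-allFalse : ∀ (xs : List ℕ) → splitGaps (map (λ i → i , false) xs) ≡ [ xs ]
  splitGaps-allFalse [] = refl
  splitGaps-allFalse (x ∷ xs) rewrite splitGaps-allFalse xs = refl

  gapWord-emptyCut : ∀ x xs k → gapWord (x ∷ xs) (replicate k false) ≡ [ restrict (x ∷ xs) (upTo (suc (length xs))) ]
  gapWord-emptyCut x xs k = cong (λ gs → map (restrict (x ∷ xs)) (filterᵇ (λ g → not (null g)) gs))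
    (trans (cong splitGaps (map-cong (λ i → cong (i ,_) (bit-allFalse k (at (x ∷ xs) i))) (upTo (suc (length xs)))))
           (splitGaps-allFalse (upTo (suc (length xs)))))

  ∈⇒≤maxL : ∀ {z} (zs : List ℕ) → z ∈ zs → z ≤ maxL zs
  ∈⇒≤maxL (z ∷ zs) (here refl) = m≤m⊔n z (maxL zs)
  ∈⇒≤maxL (y ∷ zs) (there p) = ≤-trans (∈⇒≤maxL zs p) (m≤n⊔m y (maxL zs))

  maxL-zeros : ∀ (zs : List ℕ) → All (_≡ 0) zs → maxL zs ≡ 0
  maxL-zeros [] _ = refl
  maxL-zeros (z ∷ zs) (refl ∷ h) = maxL-zeros zs h

  nblocks-std-zeros : ∀ ys → All (_≡ 0) ys → nblocks (std (0 ∷ ys)) ≡ 1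
  nblocks-std-zeros ys h = trans (cong nblocks (std-cons 0 ys)) $ cong suc (maxL-zeros (map (λ y → if y ≡ᵇ 0 then 0 else suc (indexOf y (dedup (without 0 ys)))) ys)
      (All.tabulate (λ {z} z∈ → let (y , y∈ , ez) = Data.List.Membership.Propositional.Properties.∈-map⁻ _ z∈
                                in trans ez (cong (λ t → if t ≡ᵇ 0 then 0 else suc (indexOf t (dedup (without 0 ys)))) (All.lookup h y∈)))))

  nblocks-std-nonzero : ∀ ys b → b ∈ ys → b ≢ 0 → nblocks (std (0 ∷ ys)) ≢ 1
  nblocks-std-nonzero ys b b∈ b≢0 e = suc≤⇒≢0 (≤-trans (≤-reflexive (sym q)) (∈⇒≤maxL (map F ys) (Data.List.Membership.Propositional.Properties.∈-map⁺ F b∈))) (suc-injective (trans (sym (cong nblocks (std-cons 0 ys))) e))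
    where
      F = λ y → if y ≡ᵇ 0 then 0 else suc (indexOf y (dedup (without 0 ys)))
      q : F b ≡ suc (indexOf b (dedup (without 0 ys)))
      q rewrite ≡ᵇ-false b≢0 = refl
      suc≤⇒≢0 : ∀ {m} → suc (indexOf b (dedup (without 0 ys))) ≤ m → m ≢ 0
      suc≤⇒≢0 {zero} ()
      suc≤⇒≢0 {suc m} _ ()

module FirstBlockCut where

  open BooleanReflection
  open Standardization
  open Cuts
  open GapWords
  open import Data.Nat using (ℕ; zero; suc; _<_; z<s; _≡ᵇ_; _≤ᵇ_)
  open import Data.Nat.Properties
  open import Data.Bool using (Bool; true; false; _∧_; _∨_; not; T)
  open import Data.Bool.Properties using (T?)
  open import Data.Bool.ListAction using (all)
  open import Data.List using (List; []; _∷_; length; upTo; replicate)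
  open import Data.List.Properties using (length-upTo)
  open import Data.List.Membership.Propositional using (_∈_)
  import Data.List.Membership.Propositional.Properties as MP
  open import Data.List.Relation.Unary.Any using (here)
  open import Data.List.Relation.Unary.All using ([]; _∷_)
  open import Data.Product using (_×_; _,_)
  open import Data.Empty using (⊥-elim)
  open import Data.Unit using (tt)
  open import Relation.Nullary using (¬_)
  open import Relation.Binary.PropositionalEquality using (_≡_; refl; sym; trans; cong; subst; _≢_)
  open import Function using (_∘_)

  blockOf∈⁻ : ∀ s b z → z ∈ blockOf s b → z < length s × at s z ≡ b
  blockOf∈⁻ s b z h = let (p , q) = MP.∈-filter⁻ (T? ∘ (λ i → at s i ≡ᵇ b)) {xs = upTo (length s)} h in MP.∈-upTo⁻ p , ≡ᵇ⇒ q

  blockOf∈⁺ : ∀ s b z → z < length s → at s z ≡ b → z ∈ blockOf s b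
  blockOf∈⁺ s b z z< e = MP.∈-filter⁺ (T? ∘ (λ i → at s i ≡ᵇ b)) (MP.∈-upTo⁺ z<) (⇒≡ᵇ e)

  ¬arrow-intoFirstBlock : ∀ xs i → ¬ Crossing (0 ∷ xs) → T (rgsFrom 0 (0 ∷ xs)) → i ≢ 0 → i < nblocks (0 ∷ xs) →
    ¬ T (arrow (blockOf (0 ∷ xs) i) (blockOf (0 ∷ xs) 0))
  ¬arrow-intoFirstBlock xs i nc r i≢0 i< t with label-occurs (0 ∷ xs) i r i<
  ... | p , p< , ep with blockOf (0 ∷ xs) i | blockOf∈⁺ (0 ∷ xs) i p p< ep | (λ z → blockOf∈⁻ (0 ∷ xs) i z)
  ... | [] | () | _
  ... | h ∷ tl | _ | mem =
    let (x , x∈ , tx) = any⁻ (λ x → (headL (h ∷ tl) ≤ᵇ x) ∧ (x ≤ᵇ lastL (h ∷ tl))) (blockOf (0 ∷ xs) 0) t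
        (x< , ex) = blockOf∈⁻ (0 ∷ xs) 0 x x∈
        l = lastL (h ∷ tl)
        (h< , eh) = mem h (here refl)
        (l< , el) = mem l (lastL-∈ h tl)
        h≤x = ≤ᵇ⇒≤ h x (T-∧⁻ˡ tx)
        x≤l = ≤ᵇ⇒≤ x l (T-∧⁻ʳ {h ≤ᵇ x} tx)
        x≢h : x ≢ h
        x≢h e = i≢0 (trans (sym eh) (trans (cong (at (0 ∷ xs)) (sym e)) ex))
        x≢l : x ≢ l
        x≢l e = i≢0 (trans (sym el) (trans (cong (at (0 ∷ xs)) (sym e)) ex))
        h>0 : 0 < h
        h>0 = hpos h eh
    in nc (0 , h , x , l , h>0 , ≤∧≢⇒< h≤x (λ e → x≢h (sym e)) , ≤∧≢⇒< x≤l x≢l , l< , sym ex , trans eh (sym el) ,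
           (λ e → i≢0 (trans (sym eh) (sym e))))
    where
      hpos : ∀ h → at (0 ∷ xs) h ≡ i → 0 < h
      hpos zero e = ⊥-elim (i≢0 (sym e))
      hpos (suc h) _ = z<s

  firstBlockCut : ℕ → List Bool
  firstBlockCut k = true ∷ replicate k false

  isLowerset-firstBlockCut : ∀ xs → ¬ Crossing (0 ∷ xs) → T (rgsFrom 0 (0 ∷ xs)) → T (isLowerset (0 ∷ xs) (firstBlockCut (maxL (0 ∷ xs))))
  isLowerset-firstBlockCut xs nc r = all-upTo⁺ _ (nblocks (0 ∷ xs)) outer
    where
      s = 0 ∷ xs
      bs = firstBlockCut (maxL s)
      outer : ∀ j → j < nblocks s → T (not (bit bs j) ∨ all (λ i → not (arrow (blockOf s i) (blockOf s j)) ∨ bit bs i) (upTo (nblocks s)))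
      outer (suc j) _ rewrite bit-allFalse (maxL s) j = tt
      outer zero _ = T-∨⁺ʳ {false} (all-upTo⁺ _ (nblocks s) inner)
        where
          inner : ∀ i → i < nblocks s → T (not (arrow (blockOf s i) (blockOf s 0)) ∨ bit bs i)
          inner zero _ = T-∨⁺ʳ {not (arrow (blockOf s 0) (blockOf s 0))} tt
          inner (suc i) i< = T-∨⁺ˡ (T-not⁺ (¬arrow-intoFirstBlock xs (suc i) nc r (λ ()) i<))

  isLowerset-emptyCut : ∀ s k → T (isLowerset s (replicate k false))
  isLowerset-emptyCut s k = all-upTo⁺ _ (nblocks s) (λ j _ → subst (λ b → T (not b ∨ all (λ i → not (arrow (blockOf s i) (blockOf s j)) ∨ bit (replicate k false) i) (upTo (nblocks s)))) (sym (bit-allFalse k j)) tt)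

  restrict-whole-NCP : ∀ x xs → ¬ Crossing (x ∷ xs) → T (isNCP (restrict (x ∷ xs) (upTo (suc (length xs)))))
  restrict-whole-NCP x xs nc = subst (λ X → T (isNCP (restrict (x ∷ xs) X))) (sym (upTo-range (suc (length xs))))
    (isNCP-restrict (x ∷ xs) 0 (range 1 (length xs)) (Increasing-range 0 (suc (length xs))) (Below-range 0 (suc (length xs)) (suc (length xs)) ≤-refl) nc)

  length-restrict-whole : ∀ x xs → length (restrict (x ∷ xs) (upTo (suc (length xs)))) ≡ suc (length xs)
  length-restrict-whole x xs = trans (length-restrict (x ∷ xs) (upTo (suc (length xs)))) (length-upTo (suc (length xs)))

module FiniteSums {c ℓ} (K : CommutativeRing c ℓ) where

  open import Data.List using (List; []; _∷_; map; concatMap; _++_; filter)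
  open import Data.List.Properties using (map-∘; map-++; filter-all; filter-reject)
  open import Data.List.Membership.Propositional using (_∈_)
  open import Data.List.Membership.Propositional.Properties using (∈-filter⁺; ∈-filter⁻)
  open import Data.List.Relation.Unary.Any using (here; there)
  open import Data.List.Relation.Unary.All using (All; []; _∷_)
  import Data.List.Relation.Unary.All as All
  open import Data.List.Relation.Unary.AllPairs using ([]; _∷_)
  open import Data.List.Relation.Unary.Unique.Propositional using (Unique)
  import Data.List.Relation.Unary.Unique.Propositional.Properties as UP
  open import Data.Product using (_×_; _,_)
  open import Data.Empty using (⊥-elim)
  open import Relation.Nullary using (yes; no; ¬?)
  open import Relation.Binary.Definitions using (DecidableEquality)
  open import Relation.Binary.PropositionalEquality using (refl; cong; _≢_)
  import Relation.Binary.PropositionalEquality as P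
  open import Algebra.Bundles using (CommutativeRing)
  open import Function using (_∘_)

  open CommutativeRing K renaming (refl to ≈refl; sym to ≈sym; trans to ≈trans; reflexive to ≈reflexive)
  open OverRing K
  open import Relation.Binary.Reasoning.Setoid setoid

  sum-++ : ∀ (xs ys : List Carrier) → sumK (xs ++ ys) ≈ sumK xs + sumK ys
  sum-++ [] ys = ≈sym (+-identityˡ _)
  sum-++ (x ∷ xs) ys = ≈trans (+-congˡ (sum-++ xs ys)) (≈sym (+-assoc _ _ _))

  prod-++ : ∀ (xs ys : List Carrier) → prodK (xs ++ ys) ≈ prodK xs * prodK ys
  prod-++ [] ys = ≈sym (*-identityˡ _)
  prod-++ (x ∷ xs) ys = ≈trans (*-congˡ (prod-++ xs ys)) (≈sym (*-assoc _ _ _))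

  private variable A B : Set
  sum-cong : ∀ (f g : A → Carrier) (xs : List A) → (∀ {x} → x ∈ xs → f x ≈ g x) → sumK (map f xs) ≈ sumK (map g xs)
  sum-cong f g [] h = ≈refl
  sum-cong f g (x ∷ xs) h = +-cong (h (here refl)) (sum-cong f g xs (λ p → h (there p)))

  prod-cong : ∀ (f g : A → Carrier) (xs : List A) → (∀ {x} → x ∈ xs → f x ≈ g x) → prodK (map f xs) ≈ prodK (map g xs)
  prod-cong f g [] h = ≈refl
  prod-cong f g (x ∷ xs) h = *-cong (h (here refl)) (prod-cong f g xs (λ p → h (there p)))

  sum-zero : ∀ (f : A → Carrier) (xs : List A) → (∀ {x} → x ∈ xs → f x ≈ 0#) → sumK (map f xs) ≈ 0#
  sum-zero f [] h = ≈refl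
  sum-zero f (x ∷ xs) h = ≈trans (+-cong (h (here refl)) (sum-zero f xs (λ p → h (there p)))) (+-identityˡ _)

  sum-map++ : ∀ (f : A → Carrier) (xs ys : List A) → sumK (map f (xs ++ ys)) ≈ sumK (map f xs) + sumK (map f ys)
  sum-map++ f xs ys = ≈trans (≈reflexive (cong sumK (map-++ f xs ys))) (sum-++ (map f xs) (map f ys))

  prod-map++ : ∀ (f : A → Carrier) (xs ys : List A) → prodK (map f (xs ++ ys)) ≈ prodK (map f xs) * prodK (map f ys)
  prod-map++ f xs ys = ≈trans (≈reflexive (cong prodK (map-++ f xs ys))) (prod-++ (map f xs) (map f ys))

  sum-*ˡ : ∀ a (f : A → Carrier) (xs : List A) → sumK (map (λ x → a * f x) xs) ≈ a * sumK (map f xs)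
  sum-*ˡ a f [] = ≈sym (zeroʳ a)
  sum-*ˡ a f (x ∷ xs) = ≈trans (+-congˡ (sum-*ˡ a f xs)) (≈sym (distribˡ a _ _))

  sum-*ʳ : ∀ a (f : A → Carrier) (xs : List A) → sumK (map (λ x → f x * a) xs) ≈ sumK (map f xs) * a
  sum-*ʳ a f [] = ≈sym (zeroˡ a)
  sum-*ʳ a f (x ∷ xs) = ≈trans (+-congˡ (sum-*ʳ a f xs)) (≈sym (distribʳ a _ _))

  sum-concatMap : ∀ (f : B → Carrier) (g : A → List B) (xs : List A) →
    sumK (map f (concatMap g xs)) ≈ sumK (map (λ x → sumK (map f (g x))) xs)
  sum-concatMap f g [] = ≈refl
  sum-concatMap f g (x ∷ xs) = ≈trans (sum-map++ f (g x) (concatMap g xs)) (+-congˡ (sum-concatMap f g xs))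

  sum-map-map : ∀ (f : B → Carrier) (g : A → B) (xs : List A) → sumK (map f (map g xs)) ≈ sumK (map (f ∘ g) xs)
  sum-map-map f g xs = ≈reflexive (cong sumK (P.sym (map-∘ xs)))

  module _ {A : Set} (_≟_ : DecidableEquality A) where
    remove : A → List A → List A
    remove x = filter (¬? ∘ (x ≟_))

    sum-extract : ∀ (f : A → Carrier) x (ys : List A) → Unique ys → x ∈ ys → sumK (map f ys) ≈ f x + sumK (map f (remove x ys))
    sum-extract f x (y ∷ ys) (h ∷ u) (here refl) =
      +-congˡ (≈reflexive (cong (sumK ∘ map f) (P.sym (P.trans (filter-reject (¬? ∘ (x ≟_)) (λ ne → ne refl))
                                                 (filter-all (¬? ∘ (x ≟_)) h)))))
    sum-extract f x (y ∷ ys) (h ∷ u) (there p) with x ≟ y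
    ... | yes refl = ⊥-elim (All.lookup h p refl)
    ... | no ne = begin
        f y + sumK (map f ys)
      ≈⟨ +-congˡ (sum-extract f x ys u p) ⟩
        f y + (f x + sumK (map f (remove x ys)))
      ≈⟨ ≈sym (+-assoc _ _ _) ⟩
        (f y + f x) + sumK (map f (remove x ys))
      ≈⟨ +-congʳ (+-comm _ _) ⟩
        (f x + f y) + sumK (map f (remove x ys))
      ≈⟨ +-assoc _ _ _ ⟩
        f x + (f y + sumK (map f (remove x ys))) ∎

    remove-unique : ∀ x ys → Unique ys → Unique (remove x ys)
    remove-unique x ys u = UP.filter⁺ (¬? ∘ (x ≟_)) u

    ∈-remove⁻ : ∀ x ys {z} → z ∈ remove x ys → z ∈ ys × x ≢ z
    ∈-remove⁻ x ys h = ∈-filter⁻ (¬? ∘ (x ≟_)) {xs = ys} h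

    ∈-remove⁺ : ∀ x ys {z} → z ∈ ys → x ≢ z → z ∈ remove x ys
    ∈-remove⁺ x ys h ne = ∈-filter⁺ (¬? ∘ (x ≟_)) h ne

    sum-singleSupport : ∀ (f : A → Carrier) x (ys : List A) → Unique ys → x ∈ ys → (∀ {y} → y ∈ ys → x ≢ y → f y ≈ 0#) → sumK (map f ys) ≈ f x
    sum-singleSupport f x ys u x∈ h = ≈trans (sum-extract f x ys u x∈)
      (≈trans (+-congˡ (sum-zero f (remove x ys) (λ p → let (q , ne) = ∈-remove⁻ x ys p in h q ne))) (+-identityʳ _))

    sum-sameElements : ∀ (f : A → Carrier) (xs ys : List A) → Unique xs → Unique ys →
      (∀ {z} → z ∈ xs → z ∈ ys) → (∀ {z} → z ∈ ys → z ∈ xs) → sumK (map f xs) ≈ sumK (map f ys)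
    sum-sameElements f [] [] _ _ _ _ = ≈refl
    sum-sameElements f [] (y ∷ ys) _ _ _ h with h (here refl)
    ... | ()
    sum-sameElements f (x ∷ xs) ys (hx ∷ ux) uy p q = begin
        f x + sumK (map f xs)
      ≈⟨ +-congˡ (sum-sameElements f xs (remove x ys) ux (remove-unique x ys uy)
            (λ {z} z∈ → ∈-remove⁺ x ys (p (there z∈)) (λ e → All.lookup hx z∈ e))
            (λ {z} z∈ → let (z∈' , ne) = ∈-remove⁻ x ys z∈ in lem z∈' ne)) ⟩
        f x + sumK (map f (remove x ys))
      ≈⟨ ≈sym (sum-extract f x ys uy (p (here refl))) ⟩
        sumK (map f ys) ∎
      where
        lem : ∀ {z} → z ∈ ys → x ≢ z → z ∈ xs
        lem z∈ ne with q z∈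
        ... | here e = ⊥-elim (ne (P.sym e))
        ... | there r = r

module WeightSums {c ℓ} (K : CommutativeRing c ℓ) where

  open Glueing
  open Enumeration
  open Counting
  open import Data.Nat using (ℕ; suc; _∸_) renaming (_+_ to _+ℕ_)
  open import Data.Nat using (_≟_)
  open import Data.Nat.Properties using () renaming (+-suc to ℕ+-suc; +-identityʳ to ℕ+-identityʳ)
  open import Data.List using (_∷_; map; _++_; upTo; applyUpTo)
  open import Data.List.Properties using (map-∘; ≡-dec; map-upTo; map-applyUpTo)
  open import Data.List.Membership.Propositional.Properties using (∈-upTo⁻)
  open import Relation.Binary.PropositionalEquality using (refl; cong)
  import Relation.Binary.PropositionalEquality as P
  open import Algebra.Bundles using (CommutativeRing)
  open import Function using (_∘_; id)

  open CommutativeRing K renaming (refl to ≈refl; sym to ≈sym; trans to ≈trans; reflexive to ≈reflexive)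
  open OverRing K
  open FiniteSums K
  open import Relation.Binary.Reasoning.Setoid setoid

  module _ (f : ℕ → Carrier) where
    blockWeight : Code → Carrier
    blockWeight q = prodK (map (λ b → f (count b q)) (upTo (nblocks q)))

    laterBlocksWeight : Code → Carrier
    laterBlocksWeight q = prodK (map (λ b → f (count (suc b) q)) (upTo (maxL q)))

    firstShiftedWeight : ℕ → Code → Carrier
    firstShiftedWeight j q = f (count 0 q +ℕ j) * laterBlocksWeight q

    blockWeight≈firstShifted0 : ∀ x xs → blockWeight (x ∷ xs) ≈ firstShiftedWeight 0 (x ∷ xs)
    blockWeight≈firstShifted0 x xs = begin
        prodK (map F (upTo (suc m)))
      ≈⟨ ≈reflexive (cong (prodK ∘ map F) (upTo-suc m)) ⟩
        F 0 * prodK (map F (map suc (upTo m)))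
      ≈⟨ *-cong (≈reflexive (cong f (P.sym (ℕ+-identityʳ _)))) (≈reflexive (cong prodK (P.sym (map-∘ (upTo m))))) ⟩
        firstShiftedWeight 0 (x ∷ xs) ∎
      where
        m = maxL (x ∷ xs)
        F = λ b → f (count b (x ∷ xs))

    firstShiftedWeight-glue : ∀ j C D → firstShiftedWeight j (glue C D) ≈ blockWeight C * firstShiftedWeight (suc j) D
    firstShiftedWeight-glue j C D = begin
        f (count 0 (glue C D) +ℕ j) * laterBlocksWeight (glue C D)
      ≈⟨ *-cong (≈reflexive (cong f (P.trans (cong (_+ℕ j) (count0-glue C D)) (P.sym (ℕ+-suc (count 0 D) j))))) PB ⟩
        f (count 0 D +ℕ suc j) * (blockWeight C * laterBlocksWeight D)
      ≈⟨ ≈sym (*-assoc _ _ _) ⟩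
        (f (count 0 D +ℕ suc j) * blockWeight C) * laterBlocksWeight D
      ≈⟨ *-congʳ (*-comm _ _) ⟩
        (blockWeight C * f (count 0 D +ℕ suc j)) * laterBlocksWeight D
      ≈⟨ *-assoc _ _ _ ⟩
        blockWeight C * firstShiftedWeight (suc j) D ∎
      where
        k = nblocks C
        G = λ b → f (count (suc b) (glue C D))
        PB : laterBlocksWeight (glue C D) ≈ blockWeight C * laterBlocksWeight D
        PB = begin
            prodK (map G (upTo (maxL (glue C D))))
          ≈⟨ ≈reflexive (cong (prodK ∘ map G) (P.trans (cong upTo (maxL-glue C D)) (applyUpTo-+ id k (maxL D)))) ⟩
            prodK (map G (upTo k ++ applyUpTo (k +ℕ_) (maxL D)))
          ≈⟨ prod-map++ G (upTo k) _ ⟩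
            prodK (map G (upTo k)) * prodK (map G (applyUpTo (k +ℕ_) (maxL D)))
          ≈⟨ *-cong (prod-cong G (λ b → f (count b C)) (upTo k) (λ {b} b∈ → ≈reflexive (cong f (count-glueˡ C D b (∈-upTo⁻ b∈)))))
                    (≈reflexive (cong prodK (P.trans (map-applyUpTo (k +ℕ_) G (maxL D)) (P.sym (map-upTo (G ∘ (k +ℕ_)) (maxL D)))))) ⟩
            blockWeight C * prodK (map (G ∘ (k +ℕ_)) (upTo (maxL D)))
          ≈⟨ *-congˡ (prod-cong (G ∘ (k +ℕ_)) (λ b → f (count (suc b) D)) (upTo (maxL D)) (λ {b} _ → ≈reflexive (cong f (count-glueʳ C D b)))) ⟩
            blockWeight C * laterBlocksWeight D ∎

    shiftedSum : ℕ → ℕ → Carrier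
    shiftedSum j m = sumK (map (firstShiftedWeight j) (allNCP m))

    weightSum : ℕ → Carrier
    weightSum m = sumK (map blockWeight (allNCP m))

    shiftedSum-firstBlock : ∀ j n → shiftedSum j (suc n) ≈ sumK (map (λ a → weightSum a * shiftedSum (suc j) (n ∸ a)) (upTo (suc n)))
    shiftedSum-firstBlock j n = begin
        sumK (map (firstShiftedWeight j) (allNCP (suc n)))
      ≈⟨ sum-sameElements (≡-dec _≟_) (firstShiftedWeight j) (allNCP (suc n)) (glued n) (allNCP-unique (suc n)) (glued-unique n) (λ {z} h → allNCP⊆glued n z h) (λ {z} h → glued⊆allNCP n z h) ⟩
        sumK (map (firstShiftedWeight j) (glued n))
      ≈⟨ sum-concatMap (firstShiftedWeight j) (gluedSized n) (upTo (suc n)) ⟩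
        sumK (map (λ a → sumK (map (firstShiftedWeight j) (gluedSized n a))) (upTo (suc n)))
      ≈⟨ sum-cong _ _ (upTo (suc n)) (λ {a} _ → inn a) ⟩
        sumK (map (λ a → weightSum a * shiftedSum (suc j) (n ∸ a)) (upTo (suc n))) ∎
      where
        inn : ∀ a → sumK (map (firstShiftedWeight j) (gluedSized n a)) ≈ weightSum a * shiftedSum (suc j) (n ∸ a)
        inn a = begin
            sumK (map (firstShiftedWeight j) (gluedSized n a))
          ≈⟨ sum-concatMap (firstShiftedWeight j) (λ C → map (glue C) (allNCP (n ∸ a))) (allNCP a) ⟩
            sumK (map (λ C → sumK (map (firstShiftedWeight j) (map (glue C) (allNCP (n ∸ a))))) (allNCP a))
          ≈⟨ sum-cong _ _ (allNCP a) (λ {C} _ → ≈trans (sum-map-map (firstShiftedWeight j) (glue C) (allNCP (n ∸ a)))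
                 (≈trans (sum-cong _ _ (allNCP (n ∸ a)) (λ {D} _ → firstShiftedWeight-glue j C D)) (sum-*ˡ (blockWeight C) (firstShiftedWeight (suc j)) (allNCP (n ∸ a))))) ⟩
            sumK (map (λ C → blockWeight C * shiftedSum (suc j) (n ∸ a)) (allNCP a))
          ≈⟨ sum-*ʳ (shiftedSum (suc j) (n ∸ a)) blockWeight (allNCP a) ⟩
            weightSum a * shiftedSum (suc j) (n ∸ a) ∎

module WholeWords where

  open BooleanReflection
  open GapWords
  open FirstBlockCut
  open import Data.Nat using (zero) renaming (_+_ to _+ℕ_)
  open import Data.Bool using (Bool; true; false; T)
  open import Data.List using (List; []; _∷_; map; filterᵇ; upTo; length)
  open import Data.List.Relation.Unary.All using (All; []; _∷_)
  open import Relation.Nullary using (¬_)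
  open import Relation.Binary.PropositionalEquality using (_≡_; refl; cong; cong₂)
  open import Function using (_∘_)

  T⇒≡true : ∀ {b} → T b → b ≡ true
  T⇒≡true {true} _ = refl

  filter-map : ∀ {A B : Set} (p : B → Bool) (g : A → B) (xs : List A) → filterᵇ p (map g xs) ≡ map g (filterᵇ (p ∘ g) xs)
  filter-map p g [] = refl
  filter-map p g (x ∷ xs) with p (g x)
  ... | true = cong (g x ∷_) (filter-map p g xs)
  ... | false = filter-map p g xs

  isNCP⇒rgs : ∀ xs → T (isNCP (0 ∷ xs)) → T (rgsFrom 0 (0 ∷ xs))
  isNCP⇒rgs xs h = T-∧⁻ˡ h

  isNCP⇒¬Crossing : ∀ xs → T (isNCP (0 ∷ xs)) → ¬ Crossing (0 ∷ xs)
  isNCP⇒¬Crossing xs h c = T-not⁻ (T-∧⁻ʳ {rgsFrom 0 (0 ∷ xs)} h) (Crossing⇒crossing _ c)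

  wholeWord : List Code → List Code
  wholeWord [] = []
  wholeWord (P ∷ w) = restrict P (upTo (length P)) ∷ wholeWord w

  wholeWord-NCP : ∀ w → All (λ P → T (isNCP P)) w → All (λ P → T (isNCP P)) (wholeWord w)
  wholeWord-NCP [] [] = []
  wholeWord-NCP ((zero ∷ xs) ∷ w) (h ∷ hs) = restrict-whole-NCP 0 xs (isNCP⇒¬Crossing xs h) ∷ wholeWord-NCP w hs

  size-wholeWord : ∀ w → All (λ P → T (isNCP P)) w → size (wholeWord w) ≡ size w
  size-wholeWord [] [] = refl
  size-wholeWord ((zero ∷ xs) ∷ w) (h ∷ hs) = cong₂ _+ℕ_ (length-restrict-whole 0 xs) (size-wholeWord w hs)

module CharacterIsOne {c ℓ} (K : CommutativeRing c ℓ) (ψ : List Code → CommutativeRing.Carrier K)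
  (Hψ : ∀ (w : List Code) → All (λ P → T (isNCP P)) w →
    CommutativeRing._≈_ K (ψ w) (CommutativeRing._+_ K (OverRing.εH K w) (OverRing.prec K (OverRing.e K) ψ w))) where

  open Counting
  open Cuts
  open GapWords
  open FirstBlockCut
  open import Data.Nat using (ℕ; zero; suc; _≡ᵇ_) renaming (_+_ to _+ℕ_)
  open import Data.Nat using (_<_; s≤s)
  import Data.Nat.Properties as NP
  open import Data.Bool using (Bool; true; false; if_then_else_; T)
  import Data.Bool.Properties as BP
  open import Data.List using (List; []; _∷_; [_]; map; concatMap; _++_; filterᵇ; upTo; applyUpTo; length; replicate)
  open import Data.List.Properties using (≡-dec; ++-assoc; ++-identityʳ)
  import Data.List.Properties
  open import Data.List.Membership.Propositional using (_∈_)
  import Data.List.Membership.Propositional.Properties as MP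
  open import Data.List.Relation.Unary.Any using (here; there)
  open import Data.List.Relation.Unary.All using (All; []; _∷_)
  import Data.List.Relation.Unary.All as All
  import Data.List.Relation.Unary.Unique.Propositional.Properties as UP
  open import Data.Product using (Σ; _×_; _,_; proj₁; proj₂)
  open import Data.Sum using (inj₁; inj₂)
  open import Data.Empty using (⊥; ⊥-elim)
  open import Data.Unit using (tt)
  open import Relation.Binary.PropositionalEquality using (_≡_; refl; cong; cong₂; subst; _≢_)
  import Relation.Binary.PropositionalEquality as P
  open import Algebra.Bundles using (CommutativeRing)
  open import Data.List.Relation.Unary.All.Properties using (++⁺)
  open import Data.List.Relation.Unary.Unique.Propositional using (Unique)
  open import Function using (_∘_)

  open WholeWords
  open CommutativeRing K hiding (zero) renaming (refl to ≈refl; sym to ≈sym; trans to ≈trans; reflexive to ≈reflexive)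
  open OverRing K
  open FiniteSums K
  open import Relation.Binary.Reasoning.Setoid setoid

  e-long : ∀ x (L : List Code) y L' → e ((x ∷ L) ++ (y ∷ L')) ≡ 0#
  e-long x [] y L' = refl
  e-long x (z ∷ L) y L' = refl

  cutWeight : List Code × List Code → Carrier
  cutWeight lm = e (proj₁ lm) * ψ (proj₂ lm)

  combine : Bool × List Code × List Code → List Code × List Code → List Code × List Code
  combine t lm = (proj₁ (proj₂ t) ++ proj₁ lm , proj₂ (proj₂ t) ++ proj₂ lm)

  lowerCuts : Code → List (List Bool)
  lowerCuts P = filterᵇ (isLowerset P) (subsets (nblocks P))

  ∈-lowerCuts⁻ : ∀ P {bs} → bs ∈ lowerCuts P → bs ∈ subsets (nblocks P) × T (isLowerset P bs)
  ∈-lowerCuts⁻ P {bs} m = MP.∈-filter⁻ (BP.T? ∘ isLowerset P) {xs = subsets (nblocks P)} m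

  lowerPositions-cons : ∀ s bs → (Σ ℕ λ i → i ∈ lowerPositions s bs) → Σ ℕ λ u → Σ (List ℕ) λ U' → lowerPositions s bs ≡ u ∷ U'
  lowerPositions-cons s bs (i , m) with lowerPositions s bs
  ... | [] = ⊥-elim (lem m)
    where lem : ∀ {i} → i ∈ [] → ⊥
          lem ()
  ... | u ∷ U' = u , U' , refl

  sum-cuts-emptyOnly : ∀ w' → All (λ P → T (isNCP P)) w' → ∀ x Lp Mp →
    sumK (map (λ lm → e ((x ∷ Lp) ++ proj₁ lm) * ψ (Mp ++ proj₂ lm)) (cutsW w')) ≈ e (x ∷ Lp) * ψ (Mp ++ wholeWord w')
  sum-cuts-emptyOnly [] [] x Lp Mp = ≈trans (+-identityʳ _) (*-congʳ (≈reflexive (cong e (++-identityʳ (x ∷ Lp)))))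
  sum-cuts-emptyOnly ((zero ∷ ys) ∷ w'') (hP ∷ hs) x Lp Mp = begin
      sumK (map H (cutsW (P ∷ w'')))
    ≈⟨ sum-concatMap H (λ t → map (combine t) (cutsW w'')) (cutsP P) ⟩
      sumK (map (λ t → sumK (map H (map (combine t) (cutsW w'')))) (map (cutTerm P) (lowerCuts P)))
    ≈⟨ sum-map-map _ (cutTerm P) (lowerCuts P) ⟩
      sumK (map F (lowerCuts P))
    ≈⟨ sum-singleSupport (≡-dec BP._≟_) F allF (lowerCuts P) (UP.filter⁺ (BP.T? ∘ isLowerset P) (subsets-unique (nblocks P)))
         (MP.∈-filter⁺ (BP.T? ∘ isLowerset P) (∈-subsets (nblocks P) allF (Data.List.Properties.length-replicate (nblocks P))) (isLowerset-emptyCut P (nblocks P)))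
         nonemptyCut≈0 ⟩
      F allF
    ≈⟨ sum-map-map H (combine (cutTerm P allF)) (cutsW w'') ⟩
      sumK (map (H ∘ combine (cutTerm P allF)) (cutsW w''))
    ≈⟨ sum-cong _ _ (cutsW w'') (λ {lm} _ → ≈reflexive (cong₂ (λ L M → e ((x ∷ Lp) ++ L) * ψ M)
          (cong (_++ proj₁ lm) (lowerWord-emptyCut P (nblocks P)))
          (P.trans (cong (λ t → Mp ++ (t ++ proj₂ lm)) (gapWord-emptyCut 0 ys (nblocks P))) (P.sym (++-assoc Mp [ M0P ] (proj₂ lm)))))) ⟩
      sumK (map (λ lm → e ((x ∷ Lp) ++ proj₁ lm) * ψ ((Mp ++ [ M0P ]) ++ proj₂ lm)) (cutsW w''))
    ≈⟨ sum-cuts-emptyOnly w'' hs x Lp (Mp ++ [ M0P ]) ⟩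
      e (x ∷ Lp) * ψ ((Mp ++ [ M0P ]) ++ wholeWord w'')
    ≈⟨ *-congˡ (≈reflexive (cong ψ (++-assoc Mp [ M0P ] (wholeWord w'')))) ⟩
      e (x ∷ Lp) * ψ (Mp ++ wholeWord (P ∷ w'')) ∎
    where
      P = zero ∷ ys
      M0P = restrict P (upTo (length P))
      allF = replicate (nblocks P) false
      H : List Code × List Code → Carrier
      H lm = e ((x ∷ Lp) ++ proj₁ lm) * ψ (Mp ++ proj₂ lm)
      F : List Bool → Carrier
      F bs = sumK (map H (map (combine (cutTerm P bs)) (cutsW w'')))
      nonemptyCut≈0 : ∀ {bs} → bs ∈ lowerCuts P → allF ≢ bs → F bs ≈ 0#
      nonemptyCut≈0 {bs} m ne =
        let (m1 , _) = ∈-lowerCuts⁻ P m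
            (u , U' , eU) = lowerPositions-cons P bs (lowerPositions-nonempty P bs (isNCP⇒rgs ys hP) (length-∈subsets _ bs m1) (λ e → ne (P.sym e)))
        in ≈trans (sum-map-map H (combine (cutTerm P bs)) (cutsW w''))
             (sum-zero _ (cutsW w'') (λ {lm} _ → ≈trans (*-congʳ (≈reflexive
                (P.trans (cong (λ L → e ((x ∷ Lp) ++ (L ++ proj₁ lm))) (lowerWord-nonempty P bs u U' eU)) (e-long x Lp _ _)))) (zeroˡ _)))

  module FirstFactor (xs : List ℕ) (hs : T (isNCP (0 ∷ xs))) (w : List Code) (hw : All (λ P → T (isNCP P)) w) where

    private
      s : Code
      s = 0 ∷ xs

    firstCuts : List (List Bool)
    firstCuts = filterᵇ (λ bs → bit bs 0) (lowerCuts s)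

    onlyFirstBlock : List Bool
    onlyFirstBlock = firstBlockCut (maxL s)

    reducedWeight : List Bool → Carrier
    reducedWeight bs = e (lowerWord s bs) * ψ (gapWord s bs ++ wholeWord w)

    ∈-firstCuts⁻ : ∀ {bs} → bs ∈ firstCuts → bs ∈ subsets (nblocks s) × T (isLowerset s bs) × bit bs 0 ≡ true
    ∈-firstCuts⁻ {bs} m =
      let (m₁ , b₀) = MP.∈-filter⁻ (BP.T? ∘ (λ bs → bit bs 0)) {xs = lowerCuts s} m
          (m₂ , lw) = ∈-lowerCuts⁻ s m₁
      in m₂ , lw , T⇒≡true b₀

    firstCuts-unique : Unique firstCuts
    firstCuts-unique = UP.filter⁺ (BP.T? ∘ (λ bs → bit bs 0)) (UP.filter⁺ (BP.T? ∘ isLowerset s) (subsets-unique (nblocks s)))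

    onlyFirstBlock∈firstCuts : onlyFirstBlock ∈ firstCuts
    onlyFirstBlock∈firstCuts =
      MP.∈-filter⁺ (BP.T? ∘ (λ bs → bit bs 0))
        (MP.∈-filter⁺ (BP.T? ∘ isLowerset s)
          (∈-subsets (nblocks s) onlyFirstBlock (cong suc (Data.List.Properties.length-replicate (maxL s))))
          (isLowerset-firstBlockCut xs (isNCP⇒¬Crossing xs hs) (isNCP⇒rgs xs hs)))
        tt

    lowerWord-firstCut : ∀ bs → bit bs 0 ≡ true →
      lowerWord s bs ≡ [ restrict s (0 ∷ filterᵇ (λ i → bit bs (at s i)) (applyUpTo suc (length xs))) ]
    lowerWord-firstCut bs b₀ = lowerWord-nonempty s bs 0 _ (lowerPositions-head xs bs b₀)

    sum-cuts-firstCut : ∀ bs → bs ∈ firstCuts → sumK (map cutWeight (map (combine (cutTerm s bs)) (cutsW w))) ≈ reducedWeight bs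
    sum-cuts-firstCut bs m = begin
        sumK (map cutWeight (map (combine (cutTerm s bs)) (cutsW w)))
      ≈⟨ sum-map-map cutWeight (combine (cutTerm s bs)) (cutsW w) ⟩
        sumK (map (cutWeight ∘ combine (cutTerm s bs)) (cutsW w))
      ≈⟨ sum-cong _ _ (cutsW w) (λ {lm} _ → ≈reflexive (cong (λ L → e (L ++ proj₁ lm) * ψ (gapWord s bs ++ proj₂ lm)) eL)) ⟩
        sumK (map (λ lm → e ((x ∷ []) ++ proj₁ lm) * ψ (gapWord s bs ++ proj₂ lm)) (cutsW w))
      ≈⟨ sum-cuts-emptyOnly w hw x [] (gapWord s bs) ⟩
        e [ x ] * ψ (gapWord s bs ++ wholeWord w)
      ≈⟨ *-congʳ (≈reflexive (cong e (P.sym eL))) ⟩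
        reducedWeight bs ∎
      where
        x = restrict s (0 ∷ filterᵇ (λ i → bit bs (at s i)) (applyUpTo suc (length xs)))
        eL = lowerWord-firstCut bs (proj₂ (proj₂ (∈-firstCuts⁻ m)))

    prec-as-firstCuts : prec e ψ (s ∷ w) ≈ sumK (map reducedWeight firstCuts)
    prec-as-firstCuts = begin
        sumK (map cutWeight (concatMap (λ t → map (combine t) (cutsW w)) (filterᵇ proj₁ (map (cutTerm s) (lowerCuts s)))))
      ≈⟨ ≈reflexive (cong (λ L → sumK (map cutWeight (concatMap (λ t → map (combine t) (cutsW w)) L))) (filter-map proj₁ (cutTerm s) (lowerCuts s))) ⟩
        sumK (map cutWeight (concatMap (λ t → map (combine t) (cutsW w)) (map (cutTerm s) firstCuts)))
      ≈⟨ sum-concatMap cutWeight (λ t → map (combine t) (cutsW w)) (map (cutTerm s) firstCuts) ⟩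
        sumK (map (λ t → sumK (map cutWeight (map (combine t) (cutsW w)))) (map (cutTerm s) firstCuts))
      ≈⟨ sum-map-map _ (cutTerm s) firstCuts ⟩
        sumK (map (λ bs → sumK (map cutWeight (map (combine (cutTerm s bs)) (cutsW w)))) firstCuts)
      ≈⟨ sum-cong _ reducedWeight firstCuts (λ {bs} m → sum-cuts-firstCut bs m) ⟩
        sumK (map reducedWeight firstCuts) ∎

    e-single-nonzero : ∀ Q → nblocks Q ≢ 1 → e [ Q ] ≡ 0#
    e-single-nonzero Q ne rewrite ≡ᵇ-false ne = refl

    reducedWeight-vanishes : ∀ {bs} → bs ∈ firstCuts → onlyFirstBlock ≢ bs → reducedWeight bs ≈ 0#
    reducedWeight-vanishes {[]} m ne with () ← length-∈subsets (nblocks s) [] (proj₁ (∈-firstCuts⁻ m))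
    reducedWeight-vanishes {b₀ ∷ bs'} m ne with ∈-firstCuts⁻ m
    ... | m₁ , _ , refl with findTrue bs'
    ...   | inj₂ allFalse = ⊥-elim (ne (cong (true ∷_) (P.sym (P.trans (allFalse⇒replicate bs' allFalse)
                              (cong (λ t → replicate t false) (NP.suc-injective (length-∈subsets _ _ m₁)))))))
    ...   | inj₁ (b , b< , eb) =
      let (i , i< , ei) = label-occurs s (suc b) (isNCP⇒rgs xs hs) (s≤s (subst (b <_) (NP.suc-injective (length-∈subsets _ _ m₁)) b<))
          i∈ = ∈-lowerPositions⁺ s (true ∷ bs') i i< (subst T (P.sym (P.trans (cong (bit (true ∷ bs')) ei) eb)) tt)
          i∈U = ∈-tail (subst (i ∈_) (lowerPositions-head xs (true ∷ bs') refl) i∈) ei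
          twoBlocks = nblocks-std-nonzero (map (at s) U) (suc b) (subst (_∈ map (at s) U) ei (MP.∈-map⁺ (at s) i∈U)) (λ ())
      in ≈trans (*-congʳ (≈reflexive (P.trans (cong e (lowerWord-firstCut (true ∷ bs') refl)) (e-single-nonzero (restrict s (0 ∷ U)) twoBlocks)))) (zeroˡ _)
      where
        U = filterᵇ (λ i → bit (true ∷ bs') (at s i)) (applyUpTo suc (length xs))
        ∈-tail : ∀ {i U'} → i ∈ 0 ∷ U' → at s i ≡ suc b → i ∈ U'
        ∈-tail (here refl) ()
        ∈-tail (there p) _ = p

    e-lowerWord-onlyFirstBlock : e (lowerWord s onlyFirstBlock) ≈ 1#
    e-lowerWord-onlyFirstBlock =
      ≈reflexive (P.trans (cong e (lowerWord-firstCut onlyFirstBlock refl))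
        (cong (λ n → if n ≡ᵇ 1 then 1# else 0#) (nblocks-std-zeros (map (at s) U) (All.tabulate labels≡0))))
      where
        U = filterᵇ (λ i → bit onlyFirstBlock (at s i)) (applyUpTo suc (length xs))
        marked⇒0 : ∀ j → T (bit onlyFirstBlock j) → j ≡ 0
        marked⇒0 zero _ = refl
        marked⇒0 (suc j) t = ⊥-elim (subst T (bit-allFalse (maxL s) j) t)
        labels≡0 : ∀ {z} → z ∈ map (at s) U → z ≡ 0
        labels≡0 z∈ with MP.∈-map⁻ (at s) z∈
        ... | i , i∈ , ez = P.trans ez (marked⇒0 (at s i) (proj₂ (∈-lowerPositions⁻ s onlyFirstBlock i
                              (subst (i ∈_) (P.sym (lowerPositions-head xs onlyFirstBlock refl)) (there i∈)))))

    ψ-unfold : ψ (s ∷ w) ≈ ψ (gapWord s onlyFirstBlock ++ wholeWord w)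
    ψ-unfold = begin
        ψ (s ∷ w)                                    ≈⟨ Hψ (s ∷ w) (hs ∷ hw) ⟩
        0# + prec e ψ (s ∷ w)                        ≈⟨ +-identityˡ _ ⟩
        prec e ψ (s ∷ w)                             ≈⟨ prec-as-firstCuts ⟩
        sumK (map reducedWeight firstCuts)           ≈⟨ sum-singleSupport (≡-dec BP._≟_) reducedWeight onlyFirstBlock firstCuts
                                                          firstCuts-unique onlyFirstBlock∈firstCuts reducedWeight-vanishes ⟩
        reducedWeight onlyFirstBlock                 ≈⟨ *-congʳ e-lowerWord-onlyFirstBlock ⟩
        1# * ψ (gapWord s onlyFirstBlock ++ wholeWord w)  ≈⟨ *-identityˡ _ ⟩
        ψ (gapWord s onlyFirstBlock ++ wholeWord w)  ∎

    size-reduced< : size (gapWord s onlyFirstBlock ++ wholeWord w) < suc (length xs) +ℕ size w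
    size-reduced< = subst (_< suc (length xs) +ℕ size w)
      (P.sym (P.trans (size-++ (gapWord s onlyFirstBlock) (wholeWord w)) (cong (size (gapWord s onlyFirstBlock) +ℕ_) (size-wholeWord w hw))))
      (NP.+-monoˡ-< (size w) (size-gapWord< 0 xs onlyFirstBlock refl))

    reduced-NCP : All (λ P → T (isNCP P)) (gapWord s onlyFirstBlock ++ wholeWord w)
    reduced-NCP = ++⁺ (gapWord-NCP s onlyFirstBlock (isNCP⇒¬Crossing xs hs)) (wholeWord-NCP w hw)

  ψ≈1 : ∀ n w → size w < n → All (λ P → T (isNCP P)) w → ψ w ≈ 1#
  ψ≈1 n [] _ _ = ≈trans (Hψ [] []) (+-identityʳ 1#)
  ψ≈1 (suc n) ((zero ∷ xs) ∷ w) (s≤s size≤n) (hs ∷ hw) =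
    ≈trans ψ-unfold (ψ≈1 n _ (NP.<-≤-trans size-reduced< size≤n) reduced-NCP)
    where open FirstFactor xs hs w hw

module Recurrence {c ℓ} (K : CommutativeRing c ℓ) where

  open import Data.Nat using (ℕ; zero; suc; _∸_) renaming (_+_ to _+ℕ_)
  import Data.Nat
  open import Data.Nat.Combinatorics using (_C_; nCk+nC[k+1]≡[n+1]C[k+1]; nCk≡nC[n∸k])
  import Data.Nat.Properties as NP
  open import Data.Nat.Tactic.RingSolver using (solve-∀)
  open import Relation.Binary.PropositionalEquality using (_≡_; cong; cong₂)
  import Relation.Binary.PropositionalEquality as P
  open import Algebra.Bundles using (CommutativeRing)
  import Algebra.Properties.Monoid.Mult

  open CommutativeRing K hiding (zero) renaming (refl to ≈refl; sym to ≈sym; trans to ≈trans; reflexive to ≈reflexive)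
  open OverRing K
  open import Algebra.Properties.Ring ring using (-0#≈0#)
  open import Relation.Binary.Reasoning.Setoid setoid
  open Algebra.Properties.Monoid.Mult +-monoid using (×-homo-+)
  open import Algebra.Properties.AbelianGroup +-abelianGroup using (⁻¹-∙-comm)
  open import Algebra.Properties.CommutativeSemigroup +-commutativeSemigroup using (interchange)
  open import Algebra.Properties.Ring ring using (-‿distribˡ-*)

  x≈y+z⇒y≈x-z : ∀ x y z → x ≈ y + z → y ≈ x - z
  x≈y+z⇒y≈x-z x y z x≈y+z = begin
      y            ≈⟨ ≈sym (+-identityʳ y) ⟩
      y + 0#       ≈⟨ +-congˡ (≈sym (-‿inverseʳ z)) ⟩
      y + (z - z)  ≈⟨ ≈sym (+-assoc _ _ _) ⟩
      (y + z) - z  ≈⟨ +-congʳ (≈sym x≈y+z) ⟩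
      x - z        ∎

  +-cancel-minus : ∀ x y z → (x + y) - (z + y) ≈ x - z
  +-cancel-minus x y z = begin
      (x + y) - (z + y) ≈⟨ +-congˡ (≈sym (⁻¹-∙-comm z y)) ⟩
      (x + y) + (- z + - y) ≈⟨ interchange x y (- z) (- y) ⟩
      (x - z) + (y - y) ≈⟨ +-congˡ (-‿inverseʳ y) ⟩
      (x - z) + 0# ≈⟨ +-identityʳ _ ⟩
      x - z ∎

  rearrange-zero : ∀ s x z → s * (x - z) ≈ s * ((x + x) - (z + x))
  rearrange-zero s x z = *-congˡ (≈sym (+-cancel-minus x x z))

  rearrange-suc : ∀ t x y z → (- t) * (x - z) - t * (y - x) ≈ (- t) * ((x + y) - (z + x))
  rearrange-suc t x y z = begin
      (- t) * (x - z) - t * (y - x) ≈⟨ +-congˡ (-‿distribˡ-* t (y - x)) ⟩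
      (- t) * (x - z) + (- t) * (y - x) ≈⟨ ≈sym (distribˡ _ _ _) ⟩
      (- t) * ((x - z) + (y - x)) ≈⟨ *-congˡ inner ⟩
      (- t) * ((x + y) - (z + x)) ∎
    where
      inner : (x - z) + (y - x) ≈ (x + y) - (z + x)
      inner = begin
          (x - z) + (y - x) ≈⟨ interchange x (- z) y (- x) ⟩
          (x + y) + (- z + - x) ≈⟨ +-congˡ (⁻¹-∙-comm z x) ⟩
          (x + y) - (z + x) ∎

  binomK : ℕ → ℕ → Carrier
  binomK N k = (N C k) ·ℕ 1#

  binomPredK : ℕ → ℕ → Carrier
  binomPredK N zero = 0#
  binomPredK N (suc k) = binomK N k

  sign : ℕ → Carrier
  sign zero = 1#
  sign (suc k) = - sign k

  closedForm : ℕ → ℕ → Carrier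
  closedForm i m = sign (i +ℕ m) * (binomK (m +ℕ (i +ℕ i)) i - binomPredK (m +ℕ (i +ℕ i)) i)

  pascal : ∀ N k → binomK (suc N) (suc k) ≈ binomK N k + binomK N (suc k)
  pascal N k = ≈trans (≈reflexive (cong (_·ℕ 1#) (P.sym (nCk+nC[k+1]≡[n+1]C[k+1] N k)))) (×-homo-+ 1# (N C k) (N C suc k))

  pascal′ : ∀ N k → binomK (suc N) k ≈ binomPredK N k + binomK N k
  pascal′ N zero = ≈sym (+-identityˡ _)
  pascal′ N (suc k) = pascal N k

  i≤1+2i : ∀ i → i Data.Nat.≤ suc (i +ℕ i)
  i≤1+2i i = NP.≤-trans (NP.m≤m+n i i) (NP.n≤1+n _)

  central-symmetry : ∀ i → binomK (suc (i +ℕ i)) (suc i) ≈ binomK (suc (i +ℕ i)) i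
  central-symmetry i = ≈reflexive (cong (_·ℕ 1#) (P.sym (P.trans (nCk≡nC[n∸k] (i≤1+2i i))
              (cong (suc (i +ℕ i) C_) (P.trans (cong (_∸ i) (P.sym (NP.+-suc i i))) (NP.m+n∸m≡n i (suc i)))))))

  module _ (G : ℕ → ℕ → Carrier)
           (G-step-1 : ∀ j → G j 1 ≈ G (suc j) 0)
           (G-step-≥2 : ∀ j m → G j (suc (suc m)) ≈ G (suc j) (suc m) + G (suc j) m)
           (G₀-1 : G 0 1 ≈ 1#)
           (G₀-≥2 : ∀ m → G 0 (suc (suc m)) ≈ 0#) where

    recurrence⇒closedForm : ∀ i m → G (suc i) m ≈ closedForm i m
    closedForm-0 : ∀ m → closedForm 0 m ≈ sign m
    closedForm-0 m = ≈trans (*-congˡ (≈trans (+-cong (+-identityʳ 1#) -0#≈0#) (+-identityʳ 1#))) (*-identityʳ _)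

    firstColumn : ∀ m → G 1 m ≈ sign m
    firstColumn zero = ≈trans (≈sym (G-step-1 0)) G₀-1
    firstColumn (suc m) = begin
        G 1 (suc m) ≈⟨ x≈y+z⇒y≈x-z _ _ _ (G-step-≥2 0 m) ⟩
        G 0 (suc (suc m)) - G 1 m ≈⟨ +-cong (G₀-≥2 m) (-‿cong (firstColumn m)) ⟩
        0# - sign m ≈⟨ +-identityˡ _ ⟩
        sign (suc m) ∎

    recurrence⇒closedForm zero m = ≈trans (firstColumn m) (≈sym (closedForm-0 m))
    recurrence⇒closedForm (suc i) zero = begin
        G (suc (suc i)) 0 ≈⟨ ≈sym (G-step-1 (suc i)) ⟩
        G (suc i) 1 ≈⟨ recurrence⇒closedForm i 1 ⟩
        sign (i +ℕ 1) * (binomK N i - binomPredK N i) ≈⟨ ≈reflexive (cong (λ t → sign t * (binomK N i - binomPredK N i)) (P.trans (NP.+-suc i 0) (cong suc (NP.+-identityʳ i)))) ⟩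
        sign (suc i) * (binomK N i - binomPredK N i) ≈⟨ rearrange-zero (sign (suc i)) (binomK N i) (binomPredK N i) ⟩
        sign (suc i) * ((binomK N i + binomK N i) - (binomPredK N i + binomK N i)) ≈⟨ *-congˡ (+-cong (+-congˡ (≈sym (central-symmetry i))) (-‿cong (≈sym (pascal′ N i)))) ⟩
        sign (suc i) * ((binomK N i + binomK N (suc i)) - binomK (suc N) i) ≈⟨ *-congˡ (+-congʳ (≈sym (pascal N i))) ⟩
        sign (suc i) * (binomK (suc N) (suc i) - binomK (suc N) i) ≈⟨ ≈reflexive (cong₂ (λ t u → sign t * (binomK u (suc i) - binomK u i)) (P.sym (NP.+-identityʳ (suc i))) (P.sym eN)) ⟩
        closedForm (suc i) 0 ∎
      where
        N = suc (i +ℕ i)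
        eN : suc i +ℕ suc i ≡ suc N
        eN = cong suc (NP.+-suc i i)
    recurrence⇒closedForm (suc i) (suc m) = begin
        G (suc (suc i)) (suc m) ≈⟨ x≈y+z⇒y≈x-z _ _ _ (G-step-≥2 (suc i) m) ⟩
        G (suc i) (suc (suc m)) - G (suc (suc i)) m ≈⟨ +-cong (recurrence⇒closedForm i (suc (suc m))) (-‿cong (recurrence⇒closedForm (suc i) m)) ⟩
        closedForm i (suc (suc m)) - closedForm (suc i) m ≈⟨ ≈reflexive (cong₂ (λ t u → sign t * (binomK N i - binomPredK N i) - sign (suc (i +ℕ m)) * (binomK u (suc i) - binomK u i)) e1 e2) ⟩
        (- τ) * (binomK N i - binomPredK N i) - τ * (binomK N (suc i) - binomK N i) ≈⟨ rearrange-suc τ (binomK N i) (binomK N (suc i)) (binomPredK N i) ⟩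
        (- τ) * ((binomK N i + binomK N (suc i)) - (binomPredK N i + binomK N i)) ≈⟨ *-congˡ (+-cong (≈sym (pascal N i)) (-‿cong (≈sym (pascal′ N i)))) ⟩
        (- τ) * (binomK (suc N) (suc i) - binomK (suc N) i) ≈⟨ ≈reflexive (cong₂ (λ t u → sign t * (binomK u (suc i) - binomK u i)) e3 (cong suc (P.sym e2))) ⟩
        closedForm (suc i) (suc m) ∎
      where
        N = suc (suc (m +ℕ (i +ℕ i)))
        τ = sign (suc (i +ℕ m))
        +-suc-suc : ∀ i m → i +ℕ suc (suc m) ≡ suc (suc (i +ℕ m))
        +-suc-suc = solve-∀
        reassoc : ∀ i m → m +ℕ (suc i +ℕ suc i) ≡ suc (suc (m +ℕ (i +ℕ i)))
        reassoc = solve-∀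
        e1 : i +ℕ suc (suc m) ≡ suc (suc (i +ℕ m))
        e1 = +-suc-suc i m
        e2 : m +ℕ (suc i +ℕ suc i) ≡ suc (suc (m +ℕ (i +ℕ i)))
        e2 = reassoc i m
        e3 : suc (suc (i +ℕ m)) ≡ suc i +ℕ suc m
        e3 = P.sym (NP.+-suc (suc i) m)

module CatalanIdentity where

  open import Data.Nat
  open import Data.Nat.Properties
  open import Data.Nat.DivMod using (_/_; m*n/n≡m)
  open import Data.Nat.Combinatorics using (_C_; nCk+nC[k+1]≡[n+1]C[k+1]; nCk≡nC[n∸k])
  open import Data.Nat.Tactic.RingSolver using (solve-∀)
  open import Relation.Binary.PropositionalEquality
  open ≡-Reasoning

  binom : ℕ → ℕ → ℕ
  binom n zero = 1
  binom zero (suc k) = 0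
  binom (suc n) (suc k) = binom n k + binom n (suc k)

  binom≡C : ∀ n k → binom n k ≡ n C k
  binom≡C n zero = refl
  binom≡C zero (suc k) = refl
  binom≡C (suc n) (suc k) = trans (cong₂ _+_ (binom≡C n k) (binom≡C n (suc k))) (nCk+nC[k+1]≡[n+1]C[k+1] n k)

  binom-absorption : ∀ n k → suc k * binom (suc n) (suc k) ≡ suc n * binom n k
  binom-absorption zero zero = refl
  binom-absorption zero (suc k) = *-zeroʳ (suc (suc k))
  binom-absorption (suc n) zero = begin
      1 * (1 + binom (suc n) 1) ≡⟨ *-identityˡ _ ⟩
      1 + binom (suc n) 1 ≡⟨ cong suc (trans (sym (*-identityˡ _)) (binom-absorption n 0)) ⟩
      1 + (suc n * 1) ≡⟨ cong suc (*-identityʳ (suc n)) ⟩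
      suc (suc n) ≡⟨ sym (*-identityʳ _) ⟩
      suc (suc n) * 1 ∎
  binom-absorption (suc n) (suc k) = begin
      suc (suc k) * (binom (suc n) (suc k) + binom (suc n) (suc (suc k)))
    ≡⟨ *-distribˡ-+ (suc (suc k)) (binom (suc n) (suc k)) _ ⟩
      suc (suc k) * binom (suc n) (suc k) + suc (suc k) * binom (suc n) (suc (suc k))
    ≡⟨ cong₂ _+_ (cong (binom (suc n) (suc k) +_) (binom-absorption n k)) (binom-absorption n (suc k)) ⟩
      binom (suc n) (suc k) + suc n * binom n k + suc n * binom n (suc k)
    ≡⟨ lem (binom (suc n) (suc k)) (suc n) (binom n k) (binom n (suc k)) ⟩
      binom (suc n) (suc k) + suc n * (binom n k + binom n (suc k))
    ≡⟨⟩
      suc (suc n) * binom (suc n) (suc k) ∎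
    where
      lem : ∀ a b c d → a + b * c + b * d ≡ a + b * (c + d)
      lem = solve-∀

  C-absorption : ∀ n k → suc k * (suc n C suc k) ≡ suc n * (n C k)
  C-absorption n k = trans (cong (suc k *_) (sym (binom≡C (suc n) (suc k)))) (trans (binom-absorption n k) (cong (suc n *_) (binom≡C n k)))

  Cpred : ℕ → ℕ → ℕ
  Cpred N zero = 0
  Cpred N (suc k) = N C k

  central-ratio : ∀ k → suc k * ((suc k + suc k) C suc k) ≡ suc (suc k) * ((suc k + suc k) C k)
  central-ratio k = begin
      suc k * ((suc k + suc k) C suc k)
    ≡⟨ cong (λ t → suc k * (t C suc k)) e1 ⟩
      suc k * (suc n C suc k)
    ≡⟨ C-absorption n k ⟩
      suc n * (n C k)
    ≡⟨ cong (suc n *_) (trans (nCk≡nC[n∸k] k≤n) (cong (n C_) e2)) ⟩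
      suc n * (n C suc k)
    ≡⟨ sym (C-absorption n (suc k)) ⟩
      suc (suc k) * (suc n C suc (suc k))
    ≡⟨ cong (suc (suc k) *_) (sym (trans (nCk≡nC[n∸k] k≤sn) (cong (suc n C_) e3))) ⟩
      suc (suc k) * (suc n C k)
    ≡⟨ cong (λ t → suc (suc k) * (t C k)) (sym e1) ⟩
      suc (suc k) * ((suc k + suc k) C k) ∎
    where
      n = k + suc k
      e1 : suc k + suc k ≡ suc n
      e1 = refl
      k≤n : k ≤ n
      k≤n = m≤m+n k (suc k)
      k≤sn : k ≤ suc n
      k≤sn = ≤-trans k≤n (n≤1+n n)
      e2 : n ∸ k ≡ suc k
      e2 = m+n∸m≡n k (suc k)
      e3 : suc n ∸ k ≡ suc (suc k)
      e3 = trans (+-∸-assoc 1 k≤n) (cong suc e2)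

  div-complement : ∀ i x y → i * x ≡ suc i * y → x / suc i + y ≡ x
  div-complement i x y h = begin
      x / suc i + y ≡⟨ cong (λ t → t / suc i + y) ex ⟩
      (x ∸ y) * suc i / suc i + y ≡⟨ cong (_+ y) (m*n/n≡m (x ∸ y) (suc i)) ⟩
      x ∸ y + y ≡⟨ m∸n+n≡m y≤x ⟩
      x ∎
    where
      y≤x : y ≤ x
      y≤x = *-cancelˡ-≤ (suc i) (subst (_≤ suc i * x) h (m≤n+m (i * x) x))
      ex : x ≡ (x ∸ y) * suc i
      ex = sym (begin
          (x ∸ y) * suc i ≡⟨ *-comm (x ∸ y) (suc i) ⟩
          suc i * (x ∸ y) ≡⟨ *-distribˡ-∸ (suc i) x y ⟩
          suc i * x ∸ suc i * y ≡⟨ cong (suc i * x ∸_) (sym h) ⟩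
          x + i * x ∸ i * x ≡⟨ m+n∸n≡m x (i * x) ⟩
          x ∎)

  cat+Cpred≡C : ∀ i → cat (suc i) + Cpred (i + i) i ≡ (i + i) C i
  cat+Cpred≡C zero = refl
  cat+Cpred≡C (suc k) = trans (cong (λ t → (t C suc k) / suc (suc k) + Cpred (suc k + suc k) (suc k)) e)
    (div-complement (suc k) ((suc k + suc k) C suc k) ((suc k + suc k) C k) (central-ratio k))
    where
      e : 2 * suc (suc k) ∸ 2 ≡ suc k + suc k
      e = cong (_∸ 2) (lem k)
        where
          lem : ∀ k → 2 * suc (suc k) ≡ 2 + (suc k + suc k)
          lem = solve-∀

module DiscretePartition where

  open BooleanReflection
  open Enumeration
  open Counting
  open Standardization
  open import Data.Nat using (suc)
  open import Data.Nat using (_<_)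
  import Data.Nat.Properties as NP
  open import Data.Bool using (T)
  open import Data.List using (List; []; _∷_; upTo)
  open import Data.List.Properties using (length-upTo)
  open import Data.List.Membership.Propositional using (_∈_)
  open import Data.List.Relation.Unary.All using ([]; _∷_)
  open import Data.Product using (_,_)
  open import Relation.Nullary using (¬_)
  open import Relation.Binary.PropositionalEquality using (cong; subst)
  import Relation.Binary.PropositionalEquality as P
  import Data.List.Relation.Unary.Unique.Propositional.Properties as UP
  open import Function using (_∘_; id)

  ¬Crossing-J : ∀ m → ¬ Crossing (upTo m)
  ¬Crossing-J m (a , c , b , d , a<c , c<b , b<d , d<n , e1 , e2 , ne) =
    NP.<-irrefl (P.trans (P.sym (at-app id m a a<m)) (P.trans e1 (at-app id m b b<m))) (NP.<-trans a<c c<b)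
    where
      d<m = subst (d <_) (length-upTo m) d<n
      b<m = NP.<-trans b<d d<m
      a<m = NP.<-trans (NP.<-trans a<c c<b) b<m

  J-NCP : ∀ m → T (isNCP (upTo (suc m)))
  J-NCP m = T-∧⁺ (subst (T ∘ rgsFrom 0) (P.trans (std-unique (upTo (suc m)) (UP.upTo⁺ (suc m))) (cong upTo (length-upTo (suc m))))
                   (rgs-std _ (upTo (suc m)) NP.≤-refl))
               (T-not⁺ (λ t → ¬Crossing-J (suc m) (crossing⇒Crossing _ t)))

  allNCP-isNCP : ∀ m q → q ∈ allNCP (suc m) → T (isNCP q)
  allNCP-isNCP m q h with ∈-allNCP⁻ (suc m) q h
  allNCP-isNCP m [] h | () , _ , _
  allNCP-isNCP m (x ∷ xs) h | _ , r , nc = T-∧⁺ r (T-not⁺ (λ t → nc (crossing⇒Crossing _ t)))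

module InverseOnJ {c ℓ} (K : CommutativeRing c ℓ) (ψ : List Code → CommutativeRing.Carrier K)
  (Hψ : ∀ (w : List Code) → All (λ P → T (isNCP P)) w →
    CommutativeRing._≈_ K (ψ w) (CommutativeRing._+_ K (OverRing.εH K w) (OverRing.prec K (OverRing.e K) ψ w)))
  (χ : Code → CommutativeRing.Carrier K)
  (right-inverse : ∀ (P : Code) → T (isNCP P) →
    CommutativeRing._≈_ K (OverRing.conv K (λ Q → ψ [ Q ]) χ P) (OverRing.unitA K P)) where

  open Enumeration
  open Counting
  open GapWords
  open CatalanIdentity
  open import Data.Nat using (ℕ; zero; suc; _∸_; _≡ᵇ_) renaming (_+_ to _+ℕ_)
  import Algebra.Bundles
  open import Data.Nat using (_<_)
  import Data.Nat.Properties as NP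
  open import Data.Bool using (if_then_else_; T)
  import Data.Bool.Properties as BP
  open import Data.List using (List; []; _∷_; [_]; map; filterᵇ; upTo; applyUpTo; length)
  open import Data.List.Properties using (map-∘; length-upTo)
  import Data.List.Properties
  open import Data.List.Membership.Propositional using (_∈_)
  import Data.List.Membership.Propositional.Properties as MP
  open import Data.List.Relation.Unary.All using (All; []; _∷_)
  import Data.List.Relation.Unary.All as All
  open import Data.Product using (_,_; proj₁)
  open import Relation.Binary.PropositionalEquality using (refl; cong; subst)
  import Relation.Binary.PropositionalEquality as P
  open import Algebra.Bundles using (CommutativeRing)
  open import Function using (_∘_)
  import Algebra.Properties.Monoid.Mult

  open DiscretePartition
  open CommutativeRing K hiding (zero) renaming (refl to ≈refl; sym to ≈sym; trans to ≈trans; reflexive to ≈reflexive)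
  open OverRing K
  open FiniteSums K
  open WeightSums K
  open CharacterIsOne K ψ Hψ using (ψ≈1)
  open Recurrence K
  open import Relation.Binary.Reasoning.Setoid setoid
  open Algebra.Properties.Monoid.Mult +-monoid using (×-homo-+)
  open import Algebra.Properties.Ring ring using (-1*x≈-x)
  open import Algebra.Properties.Group (Algebra.Bundles.AbelianGroup.group +-abelianGroup) using (⁻¹-involutive)

  χJ : ℕ → Carrier
  χJ k = χ (J k)

  ψ-single≈1 : ∀ m q → q ∈ allNCP (suc m) → ψ [ q ] ≈ 1#
  ψ-single≈1 m q h = ψ≈1 (suc (size [ q ])) [ q ] (NP.n<1+n _) (allNCP-isNCP m q h ∷ [])

  blocks-J-weight : ∀ m q → q ∈ allNCP m → prodK (map (λ τ → χ (restrict (upTo m) τ)) (blocks q)) ≈ blockWeight χJ q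
  blocks-J-weight m q h = ≈trans (≈reflexive (cong prodK (P.sym (map-∘ (upTo (nblocks q))))))
    (prod-cong _ _ (upTo (nblocks q)) (λ {b} _ → ≈reflexive (cong χ (P.trans
       (restrict-J m (blockOf q b) (λ {z} z∈ → subst (z <_) (proj₁ (∈-allNCP⁻ m q h)) (blockOf-bound q b z z∈)) (blockOf-uniq q b))
       (cong upTo (length-blockOf q b))))))

  conv-J≈weightSum : ∀ m → conv (λ Q → ψ [ Q ]) χ (upTo (suc m)) ≈ weightSum χJ (suc m)
  conv-J≈weightSum m = begin
      sumK (map G (filterᵇ (coarser (upTo (suc m))) (allNCP (length (upTo (suc m))))))
    ≈⟨ ≈reflexive (cong (λ L → sumK (map G L)) (P.trans (cong (λ k → filterᵇ (coarser (upTo (suc m))) (allNCP k)) (length-upTo (suc m)))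
         (Data.List.Properties.filter-all (BP.T? ∘ coarser (upTo (suc m))) {xs = allNCP (suc m)} (All.tabulate (λ {q} _ → coarser-J (suc m) q))))) ⟩
      sumK (map G (allNCP (suc m)))
    ≈⟨ sum-cong G (blockWeight χJ) (allNCP (suc m)) (λ {q} h → ≈trans (*-cong (ψ-single≈1 m q h) (blocks-J-weight (suc m) q h)) (*-identityˡ _)) ⟩
      weightSum χJ (suc m) ∎
    where
      G = λ q → ψ [ q ] * prodK (map (λ τ → χ (restrict (upTo (suc m)) τ)) (blocks q))

  weightSum-1 : weightSum χJ 1 ≈ 1#
  weightSum-1 = ≈trans (≈sym (conv-J≈weightSum 0)) (right-inverse (upTo 1) (J-NCP 0))

  weightSum-≥2 : ∀ m → weightSum χJ (suc (suc m)) ≈ 0#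
  weightSum-≥2 m = ≈trans (≈sym (conv-J≈weightSum (suc m))) (≈trans (right-inverse (upTo (suc (suc m))) (J-NCP (suc m)))
    (≈reflexive (cong (λ k → if k ≡ᵇ 1 then 1# else 0#) (nblocks-upTo (suc m)))))

  weightSum-0 : weightSum χJ 0 ≈ 1#
  weightSum-0 = +-identityʳ 1#

  shiftedSum-0 : ∀ j → shiftedSum χJ j 0 ≈ χJ j
  shiftedSum-0 j = ≈trans (+-identityʳ _) (*-identityʳ _)

  shiftedSum-unshifted : ∀ m → shiftedSum χJ 0 (suc m) ≈ weightSum χJ (suc m)
  shiftedSum-unshifted m = sum-cong _ _ (allNCP (suc m)) (λ {q} h → firstShifted0≈blockWeight q h)
    where
      firstShifted0≈blockWeight : ∀ q → q ∈ allNCP (suc m) → firstShiftedWeight χJ 0 q ≈ blockWeight χJ q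
      firstShifted0≈blockWeight [] h with () ← proj₁ (∈-allNCP⁻ (suc m) [] h)
      firstShifted0≈blockWeight (x ∷ xs) h = ≈sym (blockWeight≈firstShifted0 χJ x xs)

  shiftedSum-1 : ∀ j → shiftedSum χJ j 1 ≈ shiftedSum χJ (suc j) 0
  shiftedSum-1 j = ≈trans (shiftedSum-firstBlock χJ j 0) (≈trans (+-identityʳ _) (≈trans (*-congʳ weightSum-0) (*-identityˡ _)))

  shiftedSum-≥2 : ∀ j m → shiftedSum χJ j (suc (suc m)) ≈ shiftedSum χJ (suc j) (suc m) + shiftedSum χJ (suc j) m
  shiftedSum-≥2 j m = ≈trans (shiftedSum-firstBlock χJ j (suc m))
    (+-cong (≈trans (*-congʳ weightSum-0) (*-identityˡ _))
      (≈trans (+-congˡ (sum-zero _ (applyUpTo (λ x → suc (suc x)) m) higherTerms≈0)) (≈trans (+-identityʳ _) (≈trans (*-congʳ weightSum-1) (*-identityˡ _)))))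
    where
      higherTerms≈0 : ∀ {a} → a ∈ applyUpTo (λ x → suc (suc x)) m → weightSum χJ a * shiftedSum χJ (suc j) (suc m ∸ a) ≈ 0#
      higherTerms≈0 {a} h with MP.∈-applyUpTo⁻ (λ x → suc (suc x)) h
      ... | k , _ , refl = ≈trans (*-congʳ (weightSum-≥2 k)) (zeroˡ _)

  unshifted-1 : shiftedSum χJ 0 1 ≈ 1#
  unshifted-1 = ≈trans (shiftedSum-unshifted 0) weightSum-1

  unshifted-≥2 : ∀ m → shiftedSum χJ 0 (suc (suc m)) ≈ 0#
  unshifted-≥2 m = ≈trans (shiftedSum-unshifted (suc m)) (weightSum-≥2 m)

  -1^≈sign : ∀ k → (- 1#) ^ k ≈ sign k
  -1^≈sign zero = ≈refl
  -1^≈sign (suc k) = ≈trans (*-congˡ (-1^≈sign k)) (-1*x≈-x (sign k))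

  χ-J≈signedCat : ∀ i → χ (J (suc i)) ≈ signedCat (suc i)
  χ-J≈signedCat i = begin
      χ (J (suc i)) ≈⟨ ≈sym (shiftedSum-0 (suc i)) ⟩
      shiftedSum χJ (suc i) 0 ≈⟨ recurrence⇒closedForm (shiftedSum χJ) shiftedSum-1 shiftedSum-≥2 unshifted-1 unshifted-≥2 i 0 ⟩
      closedForm i 0 ≈⟨ *-cong (≈trans (≈reflexive (cong sign (NP.+-identityʳ i))) (≈sym (≈trans (-1^≈sign (suc (suc i))) (⁻¹-involutive (sign i))))) (≈sym (cat≈binomDifference i)) ⟩
      signedCat (suc i) ∎
    where
      cat≈binomDifference : ∀ i → cat (suc i) ·ℕ 1# ≈ binomK (i +ℕ i) i - binomPredK (i +ℕ i) i
      cat≈binomDifference i = x≈y+z⇒y≈x-z _ _ _ (≈trans (≈reflexive (cong (_·ℕ 1#) (P.sym (cat+Cpred≡C i)))) (≈trans (×-homo-+ 1# (cat (suc i)) (Cpred (i +ℕ i) i)) (+-congˡ (Cpred≈binomPredK i))))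
        where
          Cpred≈binomPredK : ∀ i → Cpred (i +ℕ i) i ·ℕ 1# ≈ binomPredK (i +ℕ i) i
          Cpred≈binomPredK zero = ≈refl
          Cpred≈binomPredK (suc k) = ≈refl

mainTheorem18 : ∀ {c ℓ} (K : CommutativeRing c ℓ) → OverRing.IsFieldChar0 K →
    (ψ : List Code → CommutativeRing.Carrier K) →
    -- ψ = ε_H + e ≺ ψ on the basis of H
    (∀ (w : List Code) → All (λ P → T (isNCP P)) w →
      CommutativeRing._≈_ K (ψ w) (CommutativeRing._+_ K (OverRing.εH K w) (OverRing.prec K (OverRing.e K) ψ w))) →
    (χ : Code → CommutativeRing.Carrier K) →
    -- χ is the inverse of ψ̄ in M_A
    (∀ (P : Code) → T (isNCP P) →
      CommutativeRing._≈_ K (OverRing.conv K χ (λ Q → ψ [ Q ]) P) (OverRing.unitA K P)) →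
    (∀ (P : Code) → T (isNCP P) →
      CommutativeRing._≈_ K (OverRing.conv K (λ Q → ψ [ Q ]) χ P) (OverRing.unitA K P)) →
    (n : ℕ) → .{{_ : NonZero n}} →
    CommutativeRing._≈_ K (χ (J n)) (OverRing.signedCat K n)
mainTheorem18 K _ ψ ψ-recursion χ _ ψ̄*χ≈1 (suc i) = InverseOnJ.χ-J≈signedCat K ψ ψ-recursion χ ψ̄*χ≈1 i
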